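{- Let $K$ be a finite simplicial complex with nonempty vertex set, $s\ge1$ and $r\ge1$. The number $S(K,r,s)$ of partitions of $V(K)$ into $r$ blocks none of which contains an $s$-simplex of $K$ satisfies \[ S(K,r,s)=\sum_{T\in L^s(K)}\mu(\emptyset,T)\,S(|\pi(T)|,r), \] where $\mu$ is the Möbius function of $L^s(K)$ and $S(n,r)$ denotes the Stirling number of the second kind.
   Context: An $s$-simplex of $K$ is a face with $s+1$ vertices; $F^s(K)$ is the set of them. For $S\subseteq F^s(K)$: the connected components of $S$ are the equivalence classes of the smallest equivalence relation on $S$ relating simplices with nonempty intersection; $V(S)=\bigcup S$; $S$ is closed if $\{\sigma\in F^s(K)\mid\sigma\subseteq V(S)\}=S$; $\pi(S)$ is the partition of $V(K)$ whose blocks are the vertex sets of the connected components of $S$ together with singletons $\{v\}$ for $v\in V(K)\setminus V(S)$. $L^s(K)$ is the set of subsets of $F^s(K)$ all of whose connected components are closed, ordered by inclusion, with least element $\emptyset$. -}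

module Defs where

open import Data.Bool using (Bool; true; false; _∧_; _∨_; not; if_then_else_; T)
open import Data.Nat using (ℕ; zero; suc; _+_; _*_)
open import Data.Integer as ℤ using (ℤ)
open import Data.Fin using (Fin; zero; suc)
open import Data.Fin.Subset using (Subset; _⊆_; ⁅_⁆; ∣_∣)
open import Data.Vec using (Vec; []; _∷_; tabulate)
import Data.Vec as Vec
open import Data.List using (List; []; _∷_; _++_; map; length; filterᵇ; foldr)
import Data.List as List

allF : ∀ {m} → (Fin m → Bool) → Bool
allF {zero}  p = true
allF {suc m} p = p zero ∧ allF (λ i → p (suc i))

anyF : ∀ {m} → (Fin m → Bool) → Bool
anyF {zero}  p = false
anyF {suc m} p = p zero ∨ anyF (λ i → p (suc i))

countF : ∀ {m} → (Fin m → Bool) → ℕ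
countF {zero}  p = 0
countF {suc m} p = (if p zero then 1 else 0) + countF (λ i → p (suc i))

_==F_ : ∀ {m} → Fin m → Fin m → Bool
zero  ==F zero  = true
zero  ==F suc _ = false
suc _ ==F zero  = false
suc i ==F suc j = i ==F j

_<F_ : ∀ {m} → Fin m → Fin m → Bool
zero  <F zero  = false
zero  <F suc _ = true
suc _ <F zero  = false
suc i <F suc j = i <F j

mem : ∀ {n} → Fin n → Subset n → Bool
mem i A = Vec.lookup A i

subB : ∀ {n} → Subset n → Subset n → Bool
subB A B = allF (λ v → not (mem v A) ∨ mem v B)

eqB : ∀ {n} → Subset n → Subset n → Bool
eqB A B = subB A B ∧ subB B A

meetsB : ∀ {n} → Subset n → Subset n → Bool
meetsB A B = anyF (λ v → mem v A ∧ mem v B)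

isEmptyB : ∀ {n} → Subset n → Bool
isEmptyB A = not (anyF (λ v → mem v A))

_==ℕ_ : ℕ → ℕ → Bool
zero  ==ℕ zero  = true
zero  ==ℕ suc _ = false
suc _ ==ℕ zero  = false
suc a ==ℕ suc b = a ==ℕ b

subsets : ∀ n → List (Subset n)
subsets zero    = [] ∷ []
subsets (suc n) = map (true ∷_) (subsets n) ++ map (false ∷_) (subsets n)

sumℤ : List ℤ → ℤ
sumℤ = foldr ℤ._+_ (ℤ.+ 0)

stirling2 : ℕ → ℕ → ℕ
stirling2 zero    zero    = 1
stirling2 zero    (suc r) = 0
stirling2 (suc n) zero    = 0
stirling2 (suc n) (suc r) = suc r * stirling2 n (suc r) + stirling2 n r

-- Finite simplicial complexes with vertex set Fin n
-- (faces are subsets of Fin n, closed under taking subsets, and every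
-- vertex is a face, so V(K) = Fin n).

record SimplicialComplex (n : ℕ) : Set where
  field
    face        : Subset n → Bool
    down-closed : ∀ {σ τ} → T (face σ) → τ ⊆ σ → T (face τ)
    vertex      : ∀ v → T (face ⁅ v ⁆)

module _ {n : ℕ} (K : SimplicialComplex n) (s : ℕ) where
  open SimplicialComplex K

  Fs : List (Subset n)
  Fs = filterᵇ (λ σ → face σ ∧ (∣ σ ∣ ==ℕ suc s)) (subsets n)

  -- number of s-simplices; a set S ⊆ F^s(K) is a Subset mFs
  mFs : ℕ
  mFs = length Fs

  simplex : Fin mFs → Subset n
  simplex = List.lookup Fs

  V : Subset mFs → Subset n
  V S = tabulate (λ v → anyF (λ i → mem i S ∧ mem v (simplex i)))

  adj : Subset mFs → Fin mFs → Fin mFs → Bool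
  adj S i j = mem i S ∧ mem j S ∧ meetsB (simplex i) (simplex j)

  reachIn : ℕ → Subset mFs → Fin mFs → Fin mFs → Bool
  reachIn zero    S i j = i ==F j
  reachIn (suc k) S i j = reachIn k S i j ∨ anyF (λ l → reachIn k S i l ∧ adj S l j)

  -- for i, j ∈ S: σᵢ and σⱼ lie in the same connected component of S
  -- (the smallest equivalence relation containing adj; paths have < mFs steps)
  sameComp : Subset mFs → Fin mFs → Fin mFs → Bool
  sameComp S = reachIn mFs S

  component : Subset mFs → Fin mFs → Subset mFs
  component S i = tabulate (λ j → mem j S ∧ sameComp S i j)

  closedB : Subset mFs → Bool
  closedB S = allF (λ j → (subB (simplex j) (V S) ∧ mem j S)
                        ∨ (not (subB (simplex j) (V S)) ∧ not (mem j S)))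

  inL : Subset mFs → Bool
  inL S = allF (λ i → not (mem i S) ∨ closedB (component S i))

  Ls : List (Subset mFs)
  Ls = filterᵇ inL (subsets mFs)

  -- |π(S)| = (number of connected components of S) + |V(K) ∖ V(S)|;
  -- components are counted by their least index.
  numComponents : Subset mFs → ℕ
  numComponents S = countF (λ i → mem i S ∧ not (anyF (λ j → (j <F i) ∧ mem j S ∧ sameComp S j i)))

  piSize : Subset mFs → ℕ
  piSize S = numComponents S + countF (λ v → not (mem v (V S)))

  -- The fuel k only needs to exceed |T| (strict subsets have smaller size).
  strictSubB : Subset mFs → Subset mFs → Bool
  strictSubB U T′ = subB U T′ ∧ not (subB T′ U)

  mobiusAux : ℕ → Subset mFs → ℤ
  mobiusAux zero    T′ = ℤ.+ 0
  mobiusAux (suc k) T′ =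
    if isEmptyB T′ then ℤ.+ 1
    else ℤ.- sumℤ (map (mobiusAux k) (filterᵇ (λ U → strictSubB U T′) Ls))

  μ∅ : Subset mFs → ℤ
  μ∅ T′ = mobiusAux (suc ∣ T′ ∣) T′

  -- Partitions of V(K) = Fin n: a partition is a set of blocks, i.e. a
  -- set of subsets of Fin n, encoded as a Subset of the list (subsets n).

  nBlocks : ℕ
  nBlocks = length (subsets n)

  block : Fin nBlocks → Subset n
  block = List.lookup (subsets n)

  isPartitionInto : ℕ → Subset nBlocks → Bool
  isPartitionInto r P =
        allF (λ b → not (mem b P) ∨ not (isEmptyB (block b)))
      ∧ allF (λ b → allF (λ c → not (mem b P ∧ mem c P ∧ not (b ==F c))
                                  ∨ not (meetsB (block b) (block c))))
      ∧ allF (λ v → anyF (λ b → mem b P ∧ mem v (block b)))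
      ∧ (∣ P ∣ ==ℕ r)

  noBlockContainsSimplex : Subset nBlocks → Bool
  noBlockContainsSimplex P =
    allF (λ b → not (mem b P) ∨ not (anyF (λ i → subB (simplex i) (block b))))

  S : ℕ → ℕ
  S r = length (filterᵇ (λ P → isPartitionInto r P ∧ noBlockContainsSimplex P)
                         (subsets nBlocks))

-- For a partition P of V(K) let T_P be the set of s-simplices contained in some block of P.
-- The components of T_P lie inside blocks, so they are closed and T_P ∈ L^s(K); moreover P is
-- coarser than π(T) exactly when T ⊆ T_P. Partitions into r blocks that are coarser than an
-- equivalence relation with c classes are counted by S(c, r) (delete vertex 0: the Stirling
-- recurrence), so S(|π(T)|, r) counts the P with T ⊆ T_P. Multiplying by μ(∅, T), summing over
-- L^s(K) and exchanging the sums leaves Σ_P Σ_{T ∈ L^s(K), T ⊆ T_P} μ(∅, T) = #{P | T_P = ∅},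
-- and T_P = ∅ says that no block contains an s-simplex.
module Submission where

open import Data.Bool using (Bool; true; false; _∧_; _∨_; not; if_then_else_; T)
open import Data.Bool.Properties using (T-irrelevant; not-involutive; ∧-identityʳ; ∧-zeroʳ; ∧-comm)
open import Data.Unit using (tt)
open import Data.Empty using (⊥; ⊥-elim)
open import Data.Product using (Σ; _×_; _,_; proj₁; proj₂)
open import Data.Sum using (_⊎_; inj₁; inj₂)
open import Data.Nat using (ℕ; zero; suc; _+_; _*_; _≤_; _<_; z≤n; s≤s)
import Data.Nat.Properties as NP
open import Data.Integer as ℤ using (ℤ)
import Data.Integer.Properties as ZP
open import Data.Fin using (Fin; zero; suc)
open import Data.Fin.Subset using (∣_∣)
open import Data.Vec using (Vec; []; _∷_; tabulate; lookup; replicate; tail)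
open import Data.Vec.Properties using (lookup∘tabulate; tabulate∘lookup; tabulate-cong)
open import Data.List using (List; []; _∷_; _++_; map; filterᵇ; length)
import Data.List as List
open import Relation.Nullary using (yes; no)
open import Relation.Binary.Structures using (IsEquivalence)
open import Relation.Binary.PropositionalEquality
open import Defs

∧-intro : ∀ {a b} → T a → T b → T (a ∧ b)
∧-intro {true} {true} _ _ = tt

∧-elimˡ : ∀ {a b} → T (a ∧ b) → T a
∧-elimˡ {true} _ = tt

∧-elimʳ : ∀ {a b} → T (a ∧ b) → T b
∧-elimʳ {true} {true} _ = tt

∨-introˡ : ∀ {a b} → T a → T (a ∨ b)
∨-introˡ {true} _ = tt

∨-introʳ : ∀ {a b} → T b → T (a ∨ b)
∨-introʳ {true} _ = tt
∨-introʳ {false} t = t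

∨-elim : ∀ {a b} → T (a ∨ b) → T a ⊎ T b
∨-elim {true} t = inj₁ tt
∨-elim {false} t = inj₂ t

not-intro : ∀ {a} → (T a → ⊥) → T (not a)
not-intro {true} f = f tt
not-intro {false} f = tt

not-elim : ∀ {a} → T (not a) → T a → ⊥
not-elim {true} () t
not-elim {false} _ ()

T-dec : ∀ b → T b ⊎ T (not b)
T-dec true = inj₁ tt
T-dec false = inj₂ tt

T⇔T⇒≡ : ∀ {a b} → (T a → T b) → (T b → T a) → a ≡ b
T⇔T⇒≡ {true} {true} f g = refl
T⇔T⇒≡ {true} {false} f g = ⊥-elim (f tt)
T⇔T⇒≡ {false} {true} f g = ⊥-elim (g tt)
T⇔T⇒≡ {false} {false} f g = refl

T⇒≡true : ∀ {b} → T b → b ≡ true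
T⇒≡true {true} _ = refl

¬T⇒≡false : ∀ {b} → (T b → ⊥) → b ≡ false
¬T⇒≡false {true} f = ⊥-elim (f tt)
¬T⇒≡false {false} _ = refl

⟦_⟧ : Bool → ℕ
⟦ b ⟧ = if b then 1 else 0

⟦not⟧+⟦⟧ : ∀ b → 1 ≡ ⟦ not b ⟧ + ⟦ b ⟧
⟦not⟧+⟦⟧ true = refl
⟦not⟧+⟦⟧ false = refl

allF-intro : ∀ {m} {p : Fin m → Bool} → (∀ i → T (p i)) → T (allF p)
allF-intro {zero} f = tt
allF-intro {suc m} f = ∧-intro (f zero) (allF-intro (λ i → f (suc i)))

allF-elim : ∀ {m} {p : Fin m → Bool} → T (allF p) → ∀ i → T (p i)
allF-elim {suc m} t zero = ∧-elimˡ t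
allF-elim {suc m} {p} t (suc i) = allF-elim {m} {λ j → p (suc j)} (∧-elimʳ {p zero} t) i

anyF-intro : ∀ {m} {p : Fin m → Bool} i → T (p i) → T (anyF p)
anyF-intro {suc m} {p} zero t = ∨-introˡ {p zero} t
anyF-intro {suc m} {p} (suc i) t = ∨-introʳ {p zero} (anyF-intro {m} {λ j → p (suc j)} i t)

anyF-elim : ∀ {m} {p : Fin m → Bool} → T (anyF p) → Σ (Fin m) (λ i → T (p i))
anyF-elim {zero} ()
anyF-elim {suc m} {p} t with ∨-elim {p zero} t
... | inj₁ x = zero , x
... | inj₂ y with anyF-elim {m} {λ j → p (suc j)} y
... | i , z = suc i , z

==F-refl : ∀ {m} (i : Fin m) → T (i ==F i)
==F-refl zero = tt
==F-refl (suc i) = ==F-refl i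

==F-≡ : ∀ {m} {i j : Fin m} → T (i ==F j) → i ≡ j
==F-≡ {i = zero} {zero} _ = refl
==F-≡ {i = suc i} {suc j} t = cong suc (==F-≡ t)

record CommMonoid : Set₁ where
  field
    Carrier : Set
    _⊕_ : Carrier → Carrier → Carrier
    ε : Carrier
    assoc : ∀ a b c → (a ⊕ b) ⊕ c ≡ a ⊕ (b ⊕ c)
    comm : ∀ a b → a ⊕ b ≡ b ⊕ a
    identityˡ : ∀ a → ε ⊕ a ≡ a

  identityʳ : ∀ a → a ⊕ ε ≡ a
  identityʳ a = trans (comm a ε) (identityˡ a)

  interchange : ∀ a b c d → (a ⊕ b) ⊕ (c ⊕ d) ≡ (a ⊕ c) ⊕ (b ⊕ d)
  interchange a b c d = begin
    (a ⊕ b) ⊕ (c ⊕ d)  ≡⟨ assoc a b (c ⊕ d) ⟩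
    a ⊕ (b ⊕ (c ⊕ d))  ≡⟨ cong (a ⊕_) (sym (assoc b c d)) ⟩
    a ⊕ ((b ⊕ c) ⊕ d)  ≡⟨ cong (λ x → a ⊕ (x ⊕ d)) (comm b c) ⟩
    a ⊕ ((c ⊕ b) ⊕ d)  ≡⟨ cong (a ⊕_) (assoc c b d) ⟩
    a ⊕ (c ⊕ (b ⊕ d))  ≡⟨ sym (assoc a c (b ⊕ d)) ⟩
    (a ⊕ c) ⊕ (b ⊕ d)  ∎
    where open ≡-Reasoning

open CommMonoid

ℕ+ : CommMonoid
ℕ+ = record { Carrier = ℕ ; _⊕_ = _+_ ; ε = 0 ; assoc = NP.+-assoc ; comm = NP.+-comm ; identityˡ = λ a → refl }

ℤ+ : CommMonoid
ℤ+ = record { Carrier = ℤ ; _⊕_ = ℤ._+_ ; ε = ℤ.+ 0 ; assoc = ZP.+-assoc ; comm = ZP.+-comm ; identityˡ = ZP.+-identityˡ }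

IsMonoidHom : (M N : CommMonoid) → (Carrier M → Carrier N) → Set
IsMonoidHom M N h = (∀ a b → h (_⊕_ M a b) ≡ _⊕_ N (h a) (h b)) × (h (ε M) ≡ ε N)

record Summation (X : Set) : Set₁ where
  field
    sum : (M : CommMonoid) → (X → Carrier M) → Carrier M
    sum-cong : ∀ M {f g : X → Carrier M} → (∀ x → f x ≡ g x) → sum M f ≡ sum M g
    sum-⊕ : ∀ M (f g : X → Carrier M) → sum M (λ x → _⊕_ M (f x) (g x)) ≡ _⊕_ M (sum M f) (sum M g)
    sum-ε : ∀ M → sum M (λ _ → ε M) ≡ ε M
    sum-hom : ∀ M N (h : Carrier M → Carrier N) → IsMonoidHom M N h → ∀ (f : X → Carrier M) → sum N (λ x → h (f x)) ≡ h (sum M f)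
    sum-swap : ∀ M {B : Set} (s : (B → Carrier M) → Carrier M) →
            (∀ (f g : B → Carrier M) → s (λ b → _⊕_ M (f b) (g b)) ≡ _⊕_ M (s f) (s g)) →
            s (λ _ → ε M) ≡ ε M →
            (∀ {f g : B → Carrier M} → (∀ b → f b ≡ g b) → s f ≡ s g) →
            ∀ (f : X → B → Carrier M) → sum M (λ x → s (f x)) ≡ s (λ b → sum M (λ x → f x b))

open Summation

ΣFin : (M : CommMonoid) → ∀ {m} → (Fin m → Carrier M) → Carrier M
ΣFin M {zero} f = ε M
ΣFin M {suc m} f = _⊕_ M (f zero) (ΣFin M (λ i → f (suc i)))

finSummation : ∀ m → Summation (Fin m)
finSummation m = record { sum = λ M → ΣFin M {m} ; sum-cong = cg m ; sum-⊕ = hm m ; sum-ε = zr m ; sum-hom = mp m ; sum-swap = sw m }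
  where
  cg : ∀ m M {f g : Fin m → Carrier M} → (∀ x → f x ≡ g x) → ΣFin M f ≡ ΣFin M g
  cg zero M e = refl
  cg (suc m) M e = cong₂ (_⊕_ M) (e zero) (cg m M (λ i → e (suc i)))
  hm : ∀ m M (f g : Fin m → Carrier M) → ΣFin M (λ x → _⊕_ M (f x) (g x)) ≡ _⊕_ M (ΣFin M f) (ΣFin M g)
  hm zero M f g = sym (identityˡ M (ε M))
  hm (suc m) M f g = trans (cong (_⊕_ M _) (hm m M _ _)) (interchange M _ _ _ _)
  zr : ∀ m M → ΣFin M {m} (λ _ → ε M) ≡ ε M
  zr zero M = refl
  zr (suc m) M = trans (cong (_⊕_ M (ε M)) (zr m M)) (identityˡ M _)
  mp : ∀ m M N (h : Carrier M → Carrier N) → IsMonoidHom M N h → ∀ (f : Fin m → Carrier M) → ΣFin N (λ x → h (f x)) ≡ h (ΣFin M f)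
  mp zero M N h (h+ , h0) f = sym h0
  mp (suc m) M N h (h+ , h0) f = trans (cong (_⊕_ N _) (mp m M N h (h+ , h0) _)) (sym (h+ _ _))
  sw : ∀ m M {B : Set} (s : (B → Carrier M) → Carrier M) →
            (∀ (f g : B → Carrier M) → s (λ b → _⊕_ M (f b) (g b)) ≡ _⊕_ M (s f) (s g)) →
            s (λ _ → ε M) ≡ ε M →
            (∀ {f g : B → Carrier M} → (∀ b → f b ≡ g b) → s f ≡ s g) →
            ∀ (f : Fin m → B → Carrier M) → ΣFin M (λ x → s (f x)) ≡ s (λ b → ΣFin M (λ x → f x b))
  sw zero M s s+ s0 sc f = sym s0
  sw (suc m) M s s+ s0 sc f = trans (cong (_⊕_ M _) (sw m M s s+ s0 sc _)) (sym (s+ _ _))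

ΣSubset : (M : CommMonoid) → ∀ n → (Vec Bool n → Carrier M) → Carrier M
ΣSubset M zero f = f []
ΣSubset M (suc n) f = _⊕_ M (ΣSubset M n (λ A → f (true ∷ A))) (ΣSubset M n (λ A → f (false ∷ A)))

subsetSummation : ∀ n → Summation (Vec Bool n)
subsetSummation n = record { sum = λ M → ΣSubset M n ; sum-cong = cg n ; sum-⊕ = hm n ; sum-ε = zr n ; sum-hom = mp n ; sum-swap = sw n }
  where
  cg : ∀ n M {f g : Vec Bool n → Carrier M} → (∀ x → f x ≡ g x) → ΣSubset M n f ≡ ΣSubset M n g
  cg zero M e = e []
  cg (suc n) M e = cong₂ (_⊕_ M) (cg n M (λ A → e (true ∷ A))) (cg n M (λ A → e (false ∷ A)))
  hm : ∀ n M (f g : Vec Bool n → Carrier M) → ΣSubset M n (λ x → _⊕_ M (f x) (g x)) ≡ _⊕_ M (ΣSubset M n f) (ΣSubset M n g)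
  hm zero M f g = refl
  hm (suc n) M f g = trans (cong₂ (_⊕_ M) (hm n M _ _) (hm n M _ _)) (interchange M _ _ _ _)
  zr : ∀ n M → ΣSubset M n (λ _ → ε M) ≡ ε M
  zr zero M = refl
  zr (suc n) M = trans (cong₂ (_⊕_ M) (zr n M) (zr n M)) (identityˡ M _)
  mp : ∀ n M N (h : Carrier M → Carrier N) → IsMonoidHom M N h → ∀ (f : Vec Bool n → Carrier M) → ΣSubset N n (λ x → h (f x)) ≡ h (ΣSubset M n f)
  mp zero M N h hh f = refl
  mp (suc n) M N h (h+ , h0) f = trans (cong₂ (_⊕_ N) (mp n M N h (h+ , h0) _) (mp n M N h (h+ , h0) _)) (sym (h+ _ _))
  sw : ∀ n M {B : Set} (s : (B → Carrier M) → Carrier M) →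
            (∀ (f g : B → Carrier M) → s (λ b → _⊕_ M (f b) (g b)) ≡ _⊕_ M (s f) (s g)) →
            s (λ _ → ε M) ≡ ε M →
            (∀ {f g : B → Carrier M} → (∀ b → f b ≡ g b) → s f ≡ s g) →
            ∀ (f : Vec Bool n → B → Carrier M) → ΣSubset M n (λ x → s (f x)) ≡ s (λ b → ΣSubset M n (λ x → f x b))
  sw zero M s s+ s0 sc f = sc (λ b → refl)
  sw (suc n) M s s+ s0 sc f = trans (cong₂ (_⊕_ M) (sw n M s s+ s0 sc _) (sw n M s s+ s0 sc _)) (sym (s+ _ _))

record FiniteType (X : Set) : Set₁ where
  field
    summation : Summation X
    eqᵇ : X → X → Bool
    eqᵇ⇒≡ : ∀ {x y} → T (eqᵇ x y) → x ≡ y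
    eqᵇ-refl : ∀ x → T (eqᵇ x x)
    sum-delta : ∀ M x0 (g : X → Carrier M) → sum summation M (λ x → if eqᵇ x0 x then g x else ε M) ≡ g x0

  sumOver : (M : CommMonoid) → (X → Carrier M) → Carrier M
  sumOver = sum summation

  eqᵇ-sym : ∀ x y → eqᵇ x y ≡ eqᵇ y x
  eqᵇ-sym x y = T⇔T⇒≡ (λ t → subst (λ z → T (eqᵇ y z)) (sym (eqᵇ⇒≡ t)) (eqᵇ-refl y))
                        (λ t → subst (λ z → T (eqᵇ x z)) (sym (eqᵇ⇒≡ t)) (eqᵇ-refl x))

  count-delta : ∀ x0 → sumOver ℕ+ (λ x → ⟦ eqᵇ x0 x ⟧) ≡ 1
  count-delta x0 = sum-delta ℕ+ x0 (λ _ → 1)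

open FiniteType

count : ∀ {X} → FiniteType X → (X → Bool) → ℕ
count XT p = sumOver XT ℕ+ (λ x → ⟦ p x ⟧)

finType : ∀ m → FiniteType (Fin m)
finType m = record { summation = finSummation m ; eqᵇ = _==F_ ; eqᵇ⇒≡ = ==F-≡ ; eqᵇ-refl = ==F-refl ; sum-delta = dm m }
  where
  zr : ∀ m M → ΣFin M {m} (λ _ → ε M) ≡ ε M
  zr m M = sum-ε (finSummation m) M
  dm : ∀ m M (x0 : Fin m) (g : Fin m → Carrier M) → ΣFin M (λ x → if x0 ==F x then g x else ε M) ≡ g x0
  dm (suc m) M zero g = trans (cong (_⊕_ M (g zero)) (zr m M)) (identityʳ M _)
  dm (suc m) M (suc x0) g = trans (identityˡ M _) (dm m M x0 (λ i → g (suc i)))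

_==ᵇ_ : Bool → Bool → Bool
true ==ᵇ true = true
false ==ᵇ false = true
_ ==ᵇ _ = false

vecEqᵇ : ∀ {n} → Vec Bool n → Vec Bool n → Bool
vecEqᵇ [] [] = true
vecEqᵇ (a ∷ A) (b ∷ B) = (a ==ᵇ b) ∧ vecEqᵇ A B

vecEqᵇ⇒≡ : ∀ {n} {A B : Vec Bool n} → T (vecEqᵇ A B) → A ≡ B
vecEqᵇ⇒≡ {A = []} {[]} t = refl
vecEqᵇ⇒≡ {A = true ∷ A} {true ∷ B} t = cong (true ∷_) (vecEqᵇ⇒≡ t)
vecEqᵇ⇒≡ {A = false ∷ A} {false ∷ B} t = cong (false ∷_) (vecEqᵇ⇒≡ t)

vecEqᵇ-refl : ∀ {n} (A : Vec Bool n) → T (vecEqᵇ A A)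
vecEqᵇ-refl [] = tt
vecEqᵇ-refl (true ∷ A) = vecEqᵇ-refl A
vecEqᵇ-refl (false ∷ A) = vecEqᵇ-refl A

subsetType : ∀ n → FiniteType (Vec Bool n)
subsetType n = record { summation = subsetSummation n ; eqᵇ = vecEqᵇ ; eqᵇ⇒≡ = vecEqᵇ⇒≡ ; eqᵇ-refl = vecEqᵇ-refl ; sum-delta = dm n }
  where
  zr : ∀ n M → ΣSubset M n (λ _ → ε M) ≡ ε M
  zr n M = sum-ε (subsetSummation n) M
  dm : ∀ n M (x0 : Vec Bool n) (g : Vec Bool n → Carrier M) → ΣSubset M n (λ x → if vecEqᵇ x0 x then g x else ε M) ≡ g x0
  dm zero M [] g = refl
  dm (suc n) M (true ∷ x0) g = trans (cong (_⊕_ M _) (zr n M)) (trans (identityʳ M _) (dm n M x0 (λ A → g (true ∷ A))))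
  dm (suc n) M (false ∷ x0) g = trans (cong₂ (_⊕_ M) (zr n M) refl) (trans (identityˡ M _) (dm n M x0 (λ A → g (false ∷ A))))

module _ {X Y : Set} (XT : FiniteType X) (YT : FiniteType Y) where

  inFibre : (c : Bool) → (T c → Y) → Y → Bool
  inFibre true f y = eqᵇ YT (f tt) y
  inFibre false f y = false

  inFibre-elim : ∀ c f y → T (inFibre c f y) → Σ (T c) λ pc → f pc ≡ y
  inFibre-elim true f y t = tt , eqᵇ⇒≡ YT t

  inFibre-intro : ∀ c f y (pc : T c) → f pc ≡ y → T (inFibre c f y)
  inFibre-intro true f y tt e = subst (λ z → T (eqᵇ YT (f tt) z)) e (eqᵇ-refl YT (f tt))

  count-inFibre : ∀ c f → sumOver YT ℕ+ (λ y → ⟦ inFibre c f y ⟧) ≡ ⟦ c ⟧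
  count-inFibre true f = count-delta YT (f tt)
  count-inFibre false f = sum-ε (summation YT) ℕ+

  count-fibres : (p : X → Bool) (F : ∀ x → T (p x) → Y) →
          count XT p ≡ sumOver YT ℕ+ (λ y → count XT (λ x → inFibre (p x) (F x) y))
  count-fibres p F = trans (sym (sum-cong (summation XT) ℕ+ (λ x → count-inFibre (p x) (F x))))
                    (sum-swap (summation XT) ℕ+ (sumOver YT ℕ+) (sum-⊕ (summation YT) ℕ+) (sum-ε (summation YT) ℕ+) (sum-cong (summation YT) ℕ+) _)

  count-bijection : (p : X → Bool) (q : Y → Bool)
        (F : ∀ x → T (p x) → Y) (G : ∀ y → T (q y) → X)
        (Fq : ∀ x px → T (q (F x px))) (Gp : ∀ y qy → T (p (G y qy)))
        (GF : ∀ x px qy → G (F x px) qy ≡ x) (FG : ∀ y qy px → F (G y qy) px ≡ y) →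
        count XT p ≡ count YT q
  count-bijection p q F G Fq Gp GF FG = trans (count-fibres p F) (sum-cong (summation YT) ℕ+ fib)
    where
    Gc : ∀ {y y'} (e : y ≡ y') (qy : T (q y)) (qy' : T (q y')) → G y qy ≡ G y' qy'
    Gc refl qy qy' = cong (G _) (T-irrelevant qy qy')
    fib : ∀ y → count XT (λ x → inFibre (p x) (F x) y) ≡ ⟦ q y ⟧
    fib y with T-dec (q y)
    ... | inj₁ qy = trans (sum-cong (summation XT) ℕ+ (λ x → cong ⟦_⟧ (pt x))) (trans (count-delta XT (G y qy)) (cong ⟦_⟧ (sym (T⇒≡true qy))))
      where
      pt : ∀ x → inFibre (p x) (F x) y ≡ eqᵇ XT (G y qy) x
      pt x = T⇔T⇒≡
        (λ t → let (px , e) = inFibre-elim (p x) (F x) y t in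
               subst (λ z → T (eqᵇ XT (G y qy) z)) (trans (Gc (sym e) qy (Fq x px)) (GF x px (Fq x px))) (eqᵇ-refl XT _))
        (λ t → let e = eqᵇ⇒≡ XT t in
               inFibre-intro (p x) (F x) y (subst (λ z → T (p z)) e (Gp y qy))
                  (subst (λ z → (pz : T (p z)) → F z pz ≡ y) e (λ pz → FG y qy pz) _))
    ... | inj₂ nq = trans (sum-cong (summation XT) ℕ+ (λ x → cong ⟦_⟧ (pt x))) (trans (sum-ε (summation XT) ℕ+) (cong ⟦_⟧ (sym (¬T⇒≡false (not-elim nq)))))
      where
      pt : ∀ x → inFibre (p x) (F x) y ≡ false
      pt x = ¬T⇒≡false (λ t → let (px , e) = inFibre-elim (p x) (F x) y t in
                               not-elim nq (subst (λ z → T (q z)) e (Fq x px)))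

  sum-reindex : ∀ M (ix : X → Y) (at : Y → X) → (∀ x → at (ix x) ≡ x) → (∀ y → ix (at y) ≡ y) →
            (f : X → Carrier M) → sumOver XT M f ≡ sumOver YT M (λ y → f (at y))
  sum-reindex M ix at ai ia f =
    trans (sym (sum-cong (summation XT) M (λ x → sum-delta YT M (ix x) (λ _ → f x))))
    (trans (sum-swap (summation XT) M (sumOver YT M) (sum-⊕ (summation YT) M) (sum-ε (summation YT) M) (sum-cong (summation YT) M) _)
    (sum-cong (summation YT) M (λ y → trans (sum-cong (summation XT) M (λ x → cong (λ b → if b then f x else ε M) (pt x y)))
                                    (sum-delta XT M (at y) f))))
    where
    pt : ∀ x y → eqᵇ YT (ix x) y ≡ eqᵇ XT (at y) x
    pt x y = T⇔T⇒≡ (λ t → subst (λ z → T (eqᵇ XT (at z) x)) (eqᵇ⇒≡ YT t) (subst (λ z → T (eqᵇ XT z x)) (sym (ai x)) (eqᵇ-refl XT x)))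
                      (λ t → subst (λ z → T (eqᵇ YT (ix z) y)) (eqᵇ⇒≡ XT t) (subst (λ z → T (eqᵇ YT z y)) (sym (ia y)) (eqᵇ-refl YT y)))

module _ {X : Set} (XT : FiniteType X) where
  count-cong : ∀ {p q : X → Bool} → (∀ x → p x ≡ q x) → count XT p ≡ count XT q
  count-cong e = sum-cong (summation XT) ℕ+ (λ x → cong ⟦_⟧ (e x))

  count-none : ∀ (p : X → Bool) → (∀ x → T (p x) → ⊥) → count XT p ≡ 0
  count-none p f = trans (count-cong (λ x → ¬T⇒≡false (f x))) (sum-ε (summation XT) ℕ+)

  count-split : ∀ (p q : X → Bool) → count XT p ≡ count XT (λ x → p x ∧ q x) + count XT (λ x → p x ∧ not (q x))
  count-split p q = trans (sum-cong (summation XT) ℕ+ (λ x → h (p x) (q x))) (sum-⊕ (summation XT) ℕ+ _ _)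
    where h : ∀ a b → ⟦ a ⟧ ≡ ⟦ a ∧ b ⟧ + ⟦ a ∧ not b ⟧
          h true true = refl
          h true false = refl
          h false b = refl

  count-∧-eqᵇ : ∀ (p : X → Bool) x → count XT (λ y → p y ∧ eqᵇ XT y x) ≡ ⟦ p x ⟧
  count-∧-eqᵇ p x = trans (sum-cong (summation XT) ℕ+ pointwise) (sum-delta XT ℕ+ x (λ _ → ⟦ p x ⟧))
    where
    pointwise : ∀ y → ⟦ p y ∧ eqᵇ XT y x ⟧ ≡ (if eqᵇ XT x y then ⟦ p x ⟧ else 0)
    pointwise y with T-dec (eqᵇ XT x y)
    ... | inj₁ x=y rewrite eqᵇ⇒≡ XT x=y | T⇒≡true (eqᵇ-refl XT y) = cong ⟦_⟧ (∧-identityʳ (p y))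
    ... | inj₂ x≠y rewrite eqᵇ-sym XT y x | ¬T⇒≡false (not-elim x≠y) = cong ⟦_⟧ (∧-zeroʳ (p y))

  sum-*ˡ : ∀ k (f : X → ℕ) → sumOver XT ℕ+ (λ x → k * f x) ≡ k * sumOver XT ℕ+ f
  sum-*ˡ k f = sum-hom (summation XT) ℕ+ ℕ+ (k *_) ((λ a b → NP.*-distribˡ-+ k a b) , NP.*-zeroʳ k) f

∣∣≡countF : ∀ {m} (P : Vec Bool m) → ∣ P ∣ ≡ countF (λ b → mem b P)
∣∣≡countF [] = refl
∣∣≡countF (true ∷ P) = cong suc (∣∣≡countF P)
∣∣≡countF (false ∷ P) = ∣∣≡countF P

countF≡count : ∀ {m} (p : Fin m → Bool) → countF p ≡ count (finType m) p
countF≡count {zero} p = refl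
countF≡count {suc m} p = cong (⟦ p zero ⟧ +_) (countF≡count (λ i → p (suc i)))

listSum : (M : CommMonoid) → ∀ {A : Set} → (A → Carrier M) → List A → Carrier M
listSum M f [] = ε M
listSum M f (x ∷ xs) = _⊕_ M (f x) (listSum M f xs)

module _ (M : CommMonoid) {A : Set} where
  listSum-filter : ∀ (g : A → Carrier M) (q : A → Bool) L → listSum M g (filterᵇ q L) ≡ listSum M (λ x → if q x then g x else ε M) L
  listSum-filter g q [] = refl
  listSum-filter g q (x ∷ L) with q x
  ... | true = cong (_⊕_ M (g x)) (listSum-filter g q L)
  ... | false = trans (listSum-filter g q L) (sym (identityˡ M _))

  listSum-map : ∀ {B : Set} (f : B → Carrier M) (k : A → B) L → listSum M f (map k L) ≡ listSum M (λ x → f (k x)) L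
  listSum-map f k [] = refl
  listSum-map f k (x ∷ L) = cong (_⊕_ M (f (k x))) (listSum-map f k L)

  listSum-++ : ∀ (f : A → Carrier M) L L' → listSum M f (L ++ L') ≡ _⊕_ M (listSum M f L) (listSum M f L')
  listSum-++ f [] L' = sym (identityˡ M _)
  listSum-++ f (x ∷ L) L' = trans (cong (_⊕_ M (f x)) (listSum-++ f L L')) (sym (assoc M _ _ _))

listSum-subsets : ∀ M n (f : Vec Bool n → Carrier M) → listSum M f (subsets n) ≡ ΣSubset M n f
listSum-subsets M zero f = identityʳ M _
listSum-subsets M (suc n) f =
  trans (listSum-++ M f (map (true ∷_) (subsets n)) (map (false ∷_) (subsets n)))
  (cong₂ (_⊕_ M) (trans (listSum-map M f (true ∷_) (subsets n)) (listSum-subsets M n _))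
                 (trans (listSum-map M f (false ∷_) (subsets n)) (listSum-subsets M n _)))

length-filter≡listSum : ∀ {A : Set} (p : A → Bool) L → length (filterᵇ p L) ≡ listSum ℕ+ (λ x → ⟦ p x ⟧) L
length-filter≡listSum p [] = refl
length-filter≡listSum p (x ∷ L) with p x
... | true = cong suc (length-filter≡listSum p L)
... | false = length-filter≡listSum p L

sumℤ-map≡listSum : ∀ {A : Set} (h : A → ℤ) L → sumℤ (map h L) ≡ listSum ℤ+ h L
sumℤ-map≡listSum h [] = refl
sumℤ-map≡listSum h (x ∷ L) = cong (λ z → h x ℤ.+ z) (sumℤ-map≡listSum h L)

length-filter-subsets : ∀ n (p : Vec Bool n → Bool) → length (filterᵇ p (subsets n)) ≡ count (subsetType n) p
length-filter-subsets n p = trans (length-filter≡listSum p (subsets n)) (listSum-subsets ℕ+ n _)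

module _ {A B : Set} where
  injectˡ : (f : A → B) (xs : List A) (ys : List B) → Fin (length xs) → Fin (length (map f xs ++ ys))
  injectˡ f (x ∷ xs) ys zero = zero
  injectˡ f (x ∷ xs) ys (suc i) = suc (injectˡ f xs ys i)

  injectʳ : (zs : List B) (g : A → B) (xs : List A) → Fin (length xs) → Fin (length (zs ++ map g xs))
  injectʳ (z ∷ zs) g xs i = suc (injectʳ zs g xs i)
  injectʳ [] g (x ∷ xs) zero = zero
  injectʳ [] g (x ∷ xs) (suc i) = suc (injectʳ [] g xs i)

  lookup-injectˡ : ∀ f xs ys i → List.lookup (map f xs ++ ys) (injectˡ f xs ys i) ≡ f (List.lookup xs i)
  lookup-injectˡ f (x ∷ xs) ys zero = refl
  lookup-injectˡ f (x ∷ xs) ys (suc i) = lookup-injectˡ f xs ys i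

  lookup-injectʳ : ∀ zs g xs i → List.lookup (zs ++ map g xs) (injectʳ zs g xs i) ≡ g (List.lookup xs i)
  lookup-injectʳ (z ∷ zs) g xs i = lookup-injectʳ zs g xs i
  lookup-injectʳ [] g (x ∷ xs) zero = refl
  lookup-injectʳ [] g (x ∷ xs) (suc i) = lookup-injectʳ [] g xs i

  injectʳ-view : ∀ g xs (i : Fin (length (map g xs))) → Σ (Fin (length xs)) λ k → i ≡ injectʳ [] g xs k
  injectʳ-view g (x ∷ xs) zero = zero , refl
  injectʳ-view g (x ∷ xs) (suc i) = let (k , e) = injectʳ-view g xs i in suc k , cong suc e

  ++-view : ∀ f g xs ys (i : Fin (length (map f xs ++ map g ys))) →
         (Σ (Fin (length xs)) λ j → i ≡ injectˡ f xs (map g ys) j) ⊎ (Σ (Fin (length ys)) λ k → i ≡ injectʳ (map f xs) g ys k)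
  ++-view f g [] ys i = inj₂ (injectʳ-view g ys i)
  ++-view f g (x ∷ xs) ys zero = inj₁ (zero , refl)
  ++-view f g (x ∷ xs) ys (suc i) with ++-view f g xs ys i
  ... | inj₁ (j , e) = inj₁ (suc j , cong suc e)
  ... | inj₂ (k , e) = inj₂ (k , cong suc e)

#subsets : ℕ → ℕ
#subsets n = length (subsets n)

indexOf : ∀ {n} → Vec Bool n → Fin (#subsets n)
indexOf {zero} [] = zero
indexOf {suc n} (true ∷ A) = injectˡ (true ∷_) (subsets n) (map (false ∷_) (subsets n)) (indexOf A)
indexOf {suc n} (false ∷ A) = injectʳ (map (true ∷_) (subsets n)) (false ∷_) (subsets n) (indexOf A)

subsetAt : ∀ {n} → Fin (#subsets n) → Vec Bool n
subsetAt {n} = List.lookup (subsets n)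

subsetAt-indexOf : ∀ {n} (A : Vec Bool n) → subsetAt (indexOf A) ≡ A
subsetAt-indexOf {zero} [] = refl
subsetAt-indexOf {suc n} (true ∷ A) = trans (lookup-injectˡ (true ∷_) (subsets n) _ (indexOf A)) (cong (true ∷_) (subsetAt-indexOf A))
subsetAt-indexOf {suc n} (false ∷ A) = trans (lookup-injectʳ (map (true ∷_) (subsets n)) (false ∷_) (subsets n) (indexOf A)) (cong (false ∷_) (subsetAt-indexOf A))

indexOf-subsetAt : ∀ {n} (i : Fin (#subsets n)) → indexOf {n} (subsetAt {n} i) ≡ i
indexOf-subsetAt {zero} zero = refl
indexOf-subsetAt {suc n} i with ++-view {A = Vec Bool n} {B = Vec Bool (suc n)} (true ∷_) (false ∷_) (subsets n) (subsets n) i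
... | inj₁ (j , refl) rewrite lookup-injectˡ {A = Vec Bool n} {B = Vec Bool (suc n)} (true ∷_) (subsets n) (map (false ∷_) (subsets n)) j =
      cong (injectˡ (true ∷_) (subsets n) (map (false ∷_) (subsets n))) (indexOf-subsetAt {n} j)
... | inj₂ (k , refl) rewrite lookup-injectʳ {A = Vec Bool n} {B = Vec Bool (suc n)} (map (true ∷_) (subsets n)) (false ∷_) (subsets n) k =
      cong (injectʳ (map (true ∷_) (subsets n)) (false ∷_) (subsets n)) (indexOf-subsetAt {n} k)

ΣFin-subsets : ∀ M n (f : Fin (#subsets n) → Carrier M) → ΣFin M f ≡ ΣSubset M n (λ A → f (indexOf A))
ΣFin-subsets M n f = sum-reindex (finType (#subsets n)) (subsetType n) M (subsetAt {n}) (indexOf {n}) (indexOf-subsetAt {n}) (subsetAt-indexOf {n}) f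

_∋_ : ∀ {n} → Vec Bool (#subsets n) → Vec Bool n → Bool
_∋_ {n} P A = mem (indexOf {n} A) P

fromPredicate : ∀ {n} → (Vec Bool n → Bool) → Vec Bool (#subsets n)
fromPredicate {n} φ = tabulate (λ b → φ (subsetAt {n} b))

∋-fromPredicate : ∀ {n} (φ : Vec Bool n → Bool) A → _∋_ {n} (fromPredicate φ) A ≡ φ A
∋-fromPredicate {n} φ A = trans (lookup∘tabulate (λ b → φ (subsetAt {n} b)) (indexOf A)) (cong φ (subsetAt-indexOf A))

vecExt : ∀ {m} {P Q : Vec Bool m} → (∀ i → lookup P i ≡ lookup Q i) → P ≡ Q
vecExt {P = P} {Q} e = trans (sym (tabulate∘lookup P)) (trans (tabulate-cong e) (tabulate∘lookup Q))

∋-extensional : ∀ {n} {P Q : Vec Bool (#subsets n)} → (∀ A → _∋_ {n} P A ≡ _∋_ {n} Q A) → P ≡ Q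
∋-extensional {n} {P} {Q} e = vecExt (λ i → subst (λ j → lookup P j ≡ lookup Q j) (indexOf-subsetAt {n} i) (e (subsetAt {n} i)))

∈-subsetAt-indexOf : ∀ {n} (A : Vec Bool n) {v} → T (mem v A) → T (mem v (subsetAt (indexOf A)))
∈-subsetAt-indexOf A {v} = subst (λ z → T (mem v z)) (sym (subsetAt-indexOf A))

mem≡∋ : ∀ {n} (P : Vec Bool (#subsets n)) (b : Fin (#subsets n)) → mem b P ≡ _∋_ {n} P (subsetAt {n} b)
mem≡∋ {n} P b = cong (λ j → lookup P j) (sym (indexOf-subsetAt {n} b))

#blocks : ∀ {n} → Vec Bool (#subsets n) → ℕ
#blocks {n} P = count (subsetType n) (λ A → _∋_ {n} P A)

∣∣≡#blocks : ∀ {n} (P : Vec Bool (#subsets n)) → ∣ P ∣ ≡ #blocks {n} P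
∣∣≡#blocks {n} P = trans (∣∣≡countF P) (trans (countF≡count (λ b → mem b P)) (ΣFin-subsets ℕ+ n (λ b → ⟦ mem b P ⟧)))

==ℕ-≡ : ∀ {a b} → T (a ==ℕ b) → a ≡ b
==ℕ-≡ {zero} {zero} t = refl
==ℕ-≡ {suc a} {suc b} t = cong suc (==ℕ-≡ t)

==ℕ-refl : ∀ a → T (a ==ℕ a)
==ℕ-refl zero = tt
==ℕ-refl (suc a) = ==ℕ-refl a

blockNonemptyᵇ : ∀ {n} → Vec Bool (#subsets n) → Fin (#subsets n) → Bool
blockNonemptyᵇ {n} P b = not (mem b P) ∨ not (isEmptyB (subsetAt {n} b))

blocksDisjointᵇ : ∀ {n} → Vec Bool (#subsets n) → Fin (#subsets n) → Fin (#subsets n) → Bool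
blocksDisjointᵇ {n} P b c = not (mem b P ∧ mem c P ∧ not (b ==F c)) ∨ not (meetsB (subsetAt {n} b) (subsetAt {n} c))

coveringBlockᵇ : ∀ {n} → Vec Bool (#subsets n) → Fin n → Fin (#subsets n) → Bool
coveringBlockᵇ {n} P v b = mem b P ∧ mem v (subsetAt {n} b)

-- Definitionally Defs.isPartitionInto K s r, which depends on neither K nor s.
isPartitionIntoᵇ : ∀ {n} → ℕ → Vec Bool (#subsets n) → Bool
isPartitionIntoᵇ {n} r P =
  allF (blockNonemptyᵇ {n} P) ∧ allF (λ b → allF (blocksDisjointᵇ {n} P b)) ∧ allF (λ v → anyF (coveringBlockᵇ {n} P v)) ∧ (∣ P ∣ ==ℕ r)

coarsensᵇ : ∀ {n} → (Fin n → Fin n → Bool) → Vec Bool (#subsets n) → Bool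
coarsensᵇ {n} E P = allF (λ u → allF (λ v → not (E u v) ∨ anyF (λ b → mem b P ∧ mem u (subsetAt {n} b) ∧ mem v (subsetAt {n} b))))

Nonempty : ∀ {n} → Vec Bool n → Set
Nonempty {n} A = Σ (Fin n) λ v → T (mem v A)

record IsPartition (n : ℕ) (P : Vec Bool (#subsets n)) : Set where
  field
    nonempty : ∀ A → T (_∋_ {n} P A) → Nonempty A
    disjoint : ∀ A B v → T (_∋_ {n} P A) → T (_∋_ {n} P B) → T (mem v A) → T (mem v B) → A ≡ B
    covers : ∀ v → Σ (Vec Bool n) λ A → T (_∋_ {n} P A) × T (mem v A)

IsPartitionInto : (n r : ℕ) (P : Vec Bool (#subsets n)) → Set
IsPartitionInto n r P = IsPartition n P × (#blocks {n} P ≡ r)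

Coarsens : ∀ {n} → (Fin n → Fin n → Bool) → Vec Bool (#subsets n) → Set
Coarsens {n} E P = ∀ u v → T (E u v) → Σ (Vec Bool n) λ A → T (_∋_ {n} P A) × T (mem u A) × T (mem v A)

isEmptyB-false⇒nonempty : ∀ {n} (A : Vec Bool n) → T (not (isEmptyB A)) → Nonempty A
isEmptyB-false⇒nonempty A t = anyF-elim (subst T (not-involutive _) t)

nonempty⇒isEmptyB-false : ∀ {n} (A : Vec Bool n) → Nonempty A → T (not (isEmptyB A))
nonempty⇒isEmptyB-false A (v , t) = subst T (sym (not-involutive _)) (anyF-intro v t)

meetsB-elim : ∀ {n} (A B : Vec Bool n) → T (meetsB A B) → Σ (Fin n) λ v → T (mem v A) × T (mem v B)
meetsB-elim A B t = let (v , x) = anyF-elim t in v , ∧-elimˡ x , ∧-elimʳ {mem v A} x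

meetsB-intro : ∀ {n} (A B : Vec Bool n) v → T (mem v A) → T (mem v B) → T (meetsB A B)
meetsB-intro A B v a b = anyF-intro v (∧-intro a b)

isPartitionIntoᵇ-sound : ∀ {n} r P → T (isPartitionIntoᵇ {n} r P) → IsPartitionInto n r P
isPartitionIntoᵇ-sound {n} r P t = record { nonempty = ne ; disjoint = dj ; covers = cv } , cd
  where
  t1 : T (allF (blockNonemptyᵇ {n} P))
  t1 = ∧-elimˡ t
  t2 : T (allF (λ b → allF (blocksDisjointᵇ {n} P b)))
  t2 = ∧-elimˡ (∧-elimʳ {allF (blockNonemptyᵇ {n} P)} t)
  t34 : T (allF (λ v → anyF (coveringBlockᵇ {n} P v)) ∧ (∣ P ∣ ==ℕ r))
  t34 = ∧-elimʳ {allF (λ b → allF (blocksDisjointᵇ {n} P b))} (∧-elimʳ {allF (blockNonemptyᵇ {n} P)} t)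
  t3 : T (allF (λ v → anyF (coveringBlockᵇ {n} P v)))
  t3 = ∧-elimˡ t34
  t4 : T (∣ P ∣ ==ℕ r)
  t4 = ∧-elimʳ {allF (λ v → anyF (coveringBlockᵇ {n} P v))} t34
  ne : ∀ A → T (_∋_ {n} P A) → Nonempty A
  ne A x with ∨-elim {not (mem (indexOf {n} A) P)} (allF-elim {p = blockNonemptyᵇ {n} P} t1 (indexOf {n} A))
  ... | inj₁ y = ⊥-elim (not-elim y x)
  ... | inj₂ y = isEmptyB-false⇒nonempty A (subst (λ z → T (not (isEmptyB z))) (subsetAt-indexOf {n} A) y)
  dj : ∀ A B v → T (_∋_ {n} P A) → T (_∋_ {n} P B) → T (mem v A) → T (mem v B) → A ≡ B
  dj A B v a b va vb with T-dec (indexOf {n} A ==F indexOf B)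
  ... | inj₁ e = trans (sym (subsetAt-indexOf {n} A)) (trans (cong (subsetAt {n}) (==F-≡ e)) (subsetAt-indexOf {n} B))
  ... | inj₂ a≢b with ∨-elim {not (mem (indexOf {n} A) P ∧ mem (indexOf {n} B) P ∧ not (indexOf {n} A ==F indexOf {n} B))}
                             (allF-elim {p = blocksDisjointᵇ {n} P (indexOf {n} A)}
                                (allF-elim {p = λ b → allF (blocksDisjointᵇ {n} P b)} t2 (indexOf {n} A)) (indexOf {n} B))
  ... | inj₁ y = ⊥-elim (not-elim y (∧-intro a (∧-intro b a≢b)))
  ... | inj₂ y = ⊥-elim (not-elim y (meetsB-intro (subsetAt {n} (indexOf {n} A)) (subsetAt {n} (indexOf {n} B)) v
                                                  (∈-subsetAt-indexOf A va) (∈-subsetAt-indexOf B vb)))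
  cv : ∀ v → Σ (Vec Bool n) λ A → T (_∋_ {n} P A) × T (mem v A)
  cv v = let (b , x) = anyF-elim {p = coveringBlockᵇ {n} P v} (allF-elim {p = λ v → anyF (coveringBlockᵇ {n} P v)} t3 v) in
         subsetAt {n} b , subst T (mem≡∋ {n} P b) (∧-elimˡ x) , ∧-elimʳ {mem b P} x
  cd : #blocks {n} P ≡ r
  cd = trans (sym (∣∣≡#blocks {n} P)) (==ℕ-≡ t4)

isPartitionIntoᵇ-complete : ∀ {n} r P → IsPartitionInto n r P → T (isPartitionIntoᵇ {n} r P)
isPartitionIntoᵇ-complete {n} r P (pp , cd) = ∧-intro t1 (∧-intro t2 (∧-intro t3 t4))
  where
  open IsPartition pp renaming (nonempty to ne; disjoint to dj; covers to cv)
  t1 = allF-intro (λ b → h1 b (T-dec (mem b P)))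
    where
    h1 : ∀ b → T (mem b P) ⊎ T (not (mem b P)) → T (not (mem b P) ∨ not (isEmptyB (subsetAt {n} b)))
    h1 b (inj₂ y) = ∨-introˡ y
    h1 b (inj₁ y) = ∨-introʳ {not (mem b P)} (nonempty⇒isEmptyB-false (subsetAt {n} b) (ne (subsetAt {n} b) (subst T (mem≡∋ {n} P b) y)))
  t2 = allF-intro (λ b → allF-intro (λ c → h2 b c (T-dec (mem b P ∧ mem c P ∧ not (b ==F c))) (T-dec (meetsB (subsetAt {n} b) (subsetAt {n} c)))))
    where
    h2 : ∀ b c → _ → _ → T (not (mem b P ∧ mem c P ∧ not (b ==F c)) ∨ not (meetsB (subsetAt {n} b) (subsetAt {n} c)))
    h2 b c (inj₂ y) _ = ∨-introˡ y
    h2 b c _ (inj₂ y) = ∨-introʳ {not (mem b P ∧ mem c P ∧ not (b ==F c))} y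
    h2 b c (inj₁ x) (inj₁ y) = ⊥-elim (not-elim (∧-elimʳ {mem c P} (∧-elimʳ {mem b P} x))
           (subst (λ z → T (z ==F c)) (sym bc) (==F-refl c)))
      where
      m = meetsB-elim (subsetAt {n} b) (subsetAt {n} c) y
      bc : b ≡ c
      bc = trans (sym (indexOf-subsetAt {n} b)) (trans (cong (indexOf {n}) (dj (subsetAt {n} b) (subsetAt {n} c) (proj₁ m) (subst T (mem≡∋ {n} P b) (∧-elimˡ x)) (subst T (mem≡∋ {n} P c) (∧-elimˡ (∧-elimʳ {mem b P} x))) (proj₁ (proj₂ m)) (proj₂ (proj₂ m)))) (indexOf-subsetAt {n} c))
  t3 = allF-intro (λ v → let (A , a , va) = cv v in anyF-intro (indexOf {n} A) (∧-intro a (∈-subsetAt-indexOf A va)))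
  t4 = subst (λ z → T (z ==ℕ r)) (sym (trans (∣∣≡#blocks {n} P) cd)) (==ℕ-refl r)

coarsensᵇ-sound : ∀ {n} E P → T (coarsensᵇ {n} E P) → Coarsens {n} E P
coarsensᵇ-sound {n} E P t u v e with ∨-elim (allF-elim (allF-elim t u) v)
... | inj₁ y = ⊥-elim (not-elim y e)
... | inj₂ y = let (b , x) = anyF-elim y in
   subsetAt {n} b , subst T (mem≡∋ {n} P b) (∧-elimˡ x) , ∧-elimˡ (∧-elimʳ {mem b P} x) , ∧-elimʳ {mem u (subsetAt {n} b)} (∧-elimʳ {mem b P} x)

coarsensᵇ-complete : ∀ {n} E P → Coarsens {n} E P → T (coarsensᵇ {n} E P)
coarsensᵇ-complete {n} E P c = allF-intro (λ u → allF-intro (λ v → h u v (T-dec (E u v))))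
  where
  h : ∀ u v → T (E u v) ⊎ T (not (E u v)) → T (not (E u v) ∨ anyF (λ b → mem b P ∧ mem u (subsetAt {n} b) ∧ mem v (subsetAt {n} b)))
  h u v (inj₂ y) = ∨-introˡ y
  h u v (inj₁ y) = let (A , a , ua , va) = c u v y in ∨-introʳ {not (E u v)} (anyF-intro (indexOf {n} A)
      (∧-intro a (∧-intro (∈-subsetAt-indexOf A ua) (∈-subsetAt-indexOf A va))))

nonemptyᵇ : ∀ {m} → Vec Bool m → Bool
nonemptyᵇ A = anyF (λ v → mem v A)

BlocksDisjoint : ∀ m → Vec Bool (#subsets m) → Set
BlocksDisjoint m P = ∀ A B v → T (_∋_ {m} P A) → T (_∋_ {m} P B) → T (mem v A) → T (mem v B) → A ≡ B

blockOf : ∀ {m} → Fin m → Vec Bool (#subsets m) → Vec Bool m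
blockOf {m} v P = tabulate (λ w → anyF (λ b → mem b P ∧ mem v (subsetAt {m} b) ∧ mem w (subsetAt {m} b)))

blockOf-unique : ∀ {m} (P : Vec Bool (#subsets m)) → BlocksDisjoint m P → ∀ A v → T (_∋_ {m} P A) → T (mem v A) → blockOf v P ≡ A
blockOf-unique {m} P dj A v a va = vecExt (λ w → trans (lookup∘tabulate _ w) (T⇔T⇒≡ (fw w) (bw w)))
  where
  fw : ∀ w → T (anyF (λ b → mem b P ∧ mem v (subsetAt {m} b) ∧ mem w (subsetAt {m} b))) → T (mem w A)
  fw w t = let (b , x) = anyF-elim {p = λ b → mem b P ∧ mem v (subsetAt {m} b) ∧ mem w (subsetAt {m} b)} t
               e = dj (subsetAt {m} b) A v (subst T (mem≡∋ {m} P b) (∧-elimˡ x)) a (∧-elimˡ (∧-elimʳ {mem b P} x)) va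
           in subst (λ z → T (mem w z)) e (∧-elimʳ {mem v (subsetAt {m} b)} (∧-elimʳ {mem b P} x))
  bw : ∀ w → T (mem w A) → T (anyF (λ b → mem b P ∧ mem v (subsetAt {m} b) ∧ mem w (subsetAt {m} b)))
  bw w t = anyF-intro {p = λ b → mem b P ∧ mem v (subsetAt {m} b) ∧ mem w (subsetAt {m} b)} (indexOf {m} A)
             (∧-intro a (∧-intro (∈-subsetAt-indexOf A va) (∈-subsetAt-indexOf A t)))

≡⇒vecEqᵇ : ∀ {m} {A B : Vec Bool m} → A ≡ B → T (vecEqᵇ A B)
≡⇒vecEqᵇ {A = A} refl = vecEqᵇ-refl A

nonemptyᵇ-intro : ∀ {m} (A : Vec Bool m) v → T (mem v A) → T (nonemptyᵇ A)
nonemptyᵇ-intro A v t = anyF-intro {p = λ v → mem v A} v t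

nonemptyᵇ-elim : ∀ {m} (A : Vec Bool m) → T (nonemptyᵇ A) → Nonempty A
nonemptyᵇ-elim A t = anyF-elim {p = λ v → mem v A} t

∉-empty : ∀ {m} (v : Fin m) → T (mem v (replicate m false)) → ⊥
∉-empty zero ()
∉-empty (suc v) t = ∉-empty v t

¬nonemptyᵇ⇒empty : ∀ {m} (A : Vec Bool m) → T (not (nonemptyᵇ A)) → A ≡ replicate m false
¬nonemptyᵇ⇒empty A t = vecExt (λ v → ¬T⇒≡false (λ x → not-elim t (nonemptyᵇ-intro A v x)) ∙ sym (¬T⇒≡false (∉-empty v)))
  where _∙_ = trans

-- deleteZero P removes 0 from its block (dropping that block if it becomes empty); insertZero P' B
-- adds 0 to the block B of P', or adds the new block {0} when B is empty.
module ZeroDeletion (n : ℕ) where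

  _∋₀_ : Vec Bool (#subsets n) → Vec Bool n → Bool
  P ∋₀ A = _∋_ {n} P A

  _∋₁_ : Vec Bool (#subsets (suc n)) → Vec Bool (suc n) → Bool
  P ∋₁ A = _∋_ {suc n} P A

  deleteZero : Vec Bool (#subsets (suc n)) → Vec Bool (#subsets n)
  deleteZero P = fromPredicate {n} (λ A → nonemptyᵇ A ∧ (P ∋₁ (true ∷ A) ∨ P ∋₁ (false ∷ A)))

  blockOfZero : Vec Bool (#subsets (suc n)) → Vec Bool n
  blockOfZero P = tail (blockOf {suc n} zero P)

  insertsZero : Vec Bool (#subsets n) → Vec Bool n → Vec Bool (suc n) → Bool
  insertsZero P' B (true ∷ A) = vecEqᵇ A B
  insertsZero P' B (false ∷ A) = P' ∋₀ A ∧ not (vecEqᵇ A B)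

  insertZero : Vec Bool (#subsets n) → Vec Bool n → Vec Bool (#subsets (suc n))
  insertZero P' B = fromPredicate {suc n} (insertsZero P' B)

  ∋-deleteZero : ∀ P A → (deleteZero P ∋₀ A) ≡ (nonemptyᵇ A ∧ (P ∋₁ (true ∷ A) ∨ P ∋₁ (false ∷ A)))
  ∋-deleteZero P A = ∋-fromPredicate {n} _ A

  ∋-insertZero : ∀ P' B A → (insertZero P' B ∋₁ A) ≡ insertsZero P' B A
  ∋-insertZero P' B A = ∋-fromPredicate {suc n} _ A

  ∋-blockOfZero : ∀ P → IsPartition (suc n) P → T (P ∋₁ (true ∷ blockOfZero P))
  ∋-blockOfZero P pp = subst (λ z → T (P ∋₁ z)) (sym e) a
    where
    c = IsPartition.covers pp zero
    A = proj₁ c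
    a = proj₁ (proj₂ c)
    e0 : blockOf zero P ≡ A
    e0 = blockOf-unique P (IsPartition.disjoint pp) A zero a (proj₂ (proj₂ c))
    hd : ∀ (X : Vec Bool (suc n)) → T (mem zero X) → X ≡ true ∷ tail X
    hd (true ∷ X) _ = refl
    e : true ∷ blockOfZero P ≡ A
    e = trans (cong (λ z → true ∷ tail z) e0) (sym (hd A (proj₂ (proj₂ c))))

  insertZero-deleteZero : ∀ P → IsPartition (suc n) P → P ≡ insertZero (deleteZero P) (blockOfZero P)
  insertZero-deleteZero P pp = ∋-extensional {suc n} (λ A → sym (trans (∋-insertZero (deleteZero P) (blockOfZero P) A) (h A)))
    where
    b0 = ∋-blockOfZero P pp
    dj = IsPartition.disjoint pp
    h : ∀ A → insertsZero (deleteZero P) (blockOfZero P) A ≡ (P ∋₁ A)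
    h (true ∷ A) = T⇔T⇒≡
      (λ t → subst (λ z → T (P ∋₁ (true ∷ z))) (sym (vecEqᵇ⇒≡ t)) b0)
      (λ t → ≡⇒vecEqᵇ (cong tail (dj (true ∷ A) (true ∷ blockOfZero P) zero t b0 tt tt)))
    h (false ∷ A) = T⇔T⇒≡ fw bw
      where
      fw : T (deleteZero P ∋₀ A ∧ not (vecEqᵇ A (blockOfZero P))) → T (P ∋₁ (false ∷ A))
      fw t with ∨-elim {P ∋₁ (true ∷ A)} (∧-elimʳ {nonemptyᵇ A} (subst T (∋-deleteZero P A) (∧-elimˡ t)))
      ... | inj₂ y = y
      ... | inj₁ y = ⊥-elim (not-elim (∧-elimʳ {deleteZero P ∋₀ A} t)
                       (≡⇒vecEqᵇ (cong tail (dj (true ∷ A) (true ∷ blockOfZero P) zero y b0 tt tt))))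
      bw : T (P ∋₁ (false ∷ A)) → T (deleteZero P ∋₀ A ∧ not (vecEqᵇ A (blockOfZero P)))
      bw t = ∧-intro (subst T (sym (∋-deleteZero P A)) (∧-intro neA (∨-introʳ {P ∋₁ (true ∷ A)} t)))
                     (not-intro (λ e → nb (vecEqᵇ⇒≡ e)))
        where
        nz : Nonempty (false ∷ A)
        nz = IsPartition.nonempty pp (false ∷ A) t
        vA : Σ (Fin n) λ v → T (mem v A)
        vA with nz
        ... | (suc v , x) = v , x
        neA = nonemptyᵇ-intro A (proj₁ vA) (proj₂ vA)
        nb : A ≡ blockOfZero P → ⊥
        nb e with dj (false ∷ A) (true ∷ blockOfZero P) (suc (proj₁ vA)) t b0 (proj₂ vA) (subst (λ z → T (mem (proj₁ vA) z)) e (proj₂ vA))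
        ... | ()

  deleteZero-isPartition : ∀ P → IsPartition (suc n) P → IsPartition n (deleteZero P)
  deleteZero-isPartition P pp = record { nonempty = ne ; disjoint = dj ; covers = cv }
    where
    ne : ∀ A → T (deleteZero P ∋₀ A) → Nonempty A
    ne A t = nonemptyᵇ-elim A (∧-elimˡ (subst T (∋-deleteZero P A) t))
    getX : ∀ A → T (deleteZero P ∋₀ A) → Σ Bool λ x → T (P ∋₁ (x ∷ A))
    getX A t with ∨-elim {P ∋₁ (true ∷ A)} (∧-elimʳ {nonemptyᵇ A} (subst T (∋-deleteZero P A) t))
    ... | inj₁ y = true , y
    ... | inj₂ y = false , y
    dj : ∀ A B v → T (deleteZero P ∋₀ A) → T (deleteZero P ∋₀ B) → T (mem v A) → T (mem v B) → A ≡ B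
    dj A B v a b va vb = let (x , xa) = getX A a ; (y , yb) = getX B b in
      cong tail (IsPartition.disjoint pp (x ∷ A) (y ∷ B) (suc v) xa yb va vb)
    cv : ∀ v → Σ (Vec Bool n) λ A → T (deleteZero P ∋₀ A) × T (mem v A)
    cv v with IsPartition.covers pp (suc v)
    ... | (x ∷ A , a , va) = A , subst T (sym (∋-deleteZero P A)) (∧-intro (nonemptyᵇ-intro A v va) (h x a)) , va
      where
      h : ∀ x → T (P ∋₁ (x ∷ A)) → T (P ∋₁ (true ∷ A) ∨ P ∋₁ (false ∷ A))
      h true t = ∨-introˡ t
      h false t = ∨-introʳ {P ∋₁ (true ∷ A)} t

  Insertable : Vec Bool (#subsets n) → Vec Bool n → Set
  Insertable P' B = T (P' ∋₀ B) ⊎ (B ≡ replicate n false)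

  insertZero-isPartition : ∀ P' B → IsPartition n P' → Insertable P' B → IsPartition (suc n) (insertZero P' B)
  insertZero-isPartition P' B pp bok = record { nonempty = ne ; disjoint = dj ; covers = cv }
    where
    r2 : ∀ A → T (insertZero P' B ∋₁ A) → T (insertsZero P' B A)
    r2 A t = subst T (∋-insertZero P' B A) t
    r2' : ∀ A → T (insertsZero P' B A) → T (insertZero P' B ∋₁ A)
    r2' A t = subst T (sym (∋-insertZero P' B A)) t
    ne : ∀ A → T (insertZero P' B ∋₁ A) → Nonempty A
    ne (true ∷ A) t = zero , tt
    ne (false ∷ A) t = let (v , x) = IsPartition.nonempty pp A (∧-elimˡ (r2 (false ∷ A) t)) in suc v , x
    Bin : ∀ v → T (mem v B) → T (P' ∋₀ B)
    Bin v x = fb bok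
      where
      fb : Insertable P' B → T (P' ∋₀ B)
      fb (inj₁ y) = y
      fb (inj₂ e) = ⊥-elim (∉-empty v (subst (λ z → T (mem v z)) e x))
    dj : ∀ A A' v → T (insertZero P' B ∋₁ A) → T (insertZero P' B ∋₁ A') → T (mem v A) → T (mem v A') → A ≡ A'
    dj (true ∷ A) (true ∷ A') v a a' _ _ = cong (true ∷_) (trans (vecEqᵇ⇒≡ (r2 (true ∷ A) a)) (sym (vecEqᵇ⇒≡ (r2 (true ∷ A') a'))))
    dj (false ∷ A) (false ∷ A') (suc v) a a' va va' = cong (false ∷_) (IsPartition.disjoint pp A A' v (∧-elimˡ (r2 (false ∷ A) a)) (∧-elimˡ (r2 (false ∷ A') a')) va va')
    dj (true ∷ A) (false ∷ A') (suc v) a a' va va' =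
      ⊥-elim (not-elim (∧-elimʳ {P' ∋₀ A'} (r2 (false ∷ A') a'))
        (≡⇒vecEqᵇ {A = A'} {B = B} (IsPartition.disjoint pp A' B v (∧-elimˡ (r2 (false ∷ A') a')) (Bin v vB) va' vB)))
      where vB : T (mem v B)
            vB = subst (λ z → T (mem v z)) (vecEqᵇ⇒≡ {A = A} {B = B} (r2 (true ∷ A) a)) va
    dj (false ∷ A) (true ∷ A') (suc v) a a' va va' =
      ⊥-elim (not-elim (∧-elimʳ {P' ∋₀ A} (r2 (false ∷ A) a))
        (≡⇒vecEqᵇ {A = A} {B = B} (IsPartition.disjoint pp A B v (∧-elimˡ (r2 (false ∷ A) a)) (Bin v vB) va vB)))
      where vB : T (mem v B)
            vB = subst (λ z → T (mem v z)) (vecEqᵇ⇒≡ {A = A'} {B = B} (r2 (true ∷ A') a')) va'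
    cv : ∀ v → Σ (Vec Bool (suc n)) λ A → T (insertZero P' B ∋₁ A) × T (mem v A)
    cv zero = true ∷ B , r2' (true ∷ B) (vecEqᵇ-refl B) , tt
    cv (suc v) with IsPartition.covers pp v
    ... | (A , a , va) with T-dec (vecEqᵇ A B)
    ... | inj₁ e = true ∷ A , r2' (true ∷ A) e , va
    ... | inj₂ ne' = false ∷ A , r2' (false ∷ A) (∧-intro a ne') , va

  deleteZero-insertZero : ∀ P' B → IsPartition n P' → Insertable P' B → deleteZero (insertZero P' B) ≡ P'
  deleteZero-insertZero P' B pp bok = ∋-extensional {n} (λ A → trans (∋-deleteZero (insertZero P' B) A) (T⇔T⇒≡ (fw A) (bw A)))
    where
    fw : ∀ A → T (nonemptyᵇ A ∧ (insertZero P' B ∋₁ (true ∷ A) ∨ insertZero P' B ∋₁ (false ∷ A))) → T (P' ∋₀ A)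
    fw A t with ∨-elim {insertZero P' B ∋₁ (true ∷ A)} (∧-elimʳ {nonemptyᵇ A} t)
    ... | inj₂ y = ∧-elimˡ (subst T (∋-insertZero P' B (false ∷ A)) y)
    ... | inj₁ y = fb bok
      where
      fb : Insertable P' B → T (P' ∋₀ A)
      fb (inj₁ bi) = subst (λ z → T (P' ∋₀ z)) (sym (vecEqᵇ⇒≡ (subst T (∋-insertZero P' B (true ∷ A)) y))) bi
      fb (inj₂ e) = let (v , x) = nonemptyᵇ-elim A (∧-elimˡ t) in
                   ⊥-elim (∉-empty v (subst (λ z → T (mem v z)) (trans (vecEqᵇ⇒≡ {A = A} {B = B} (subst T (∋-insertZero P' B (true ∷ A)) y)) e) x))
    bw : ∀ A → T (P' ∋₀ A) → T (nonemptyᵇ A ∧ (insertZero P' B ∋₁ (true ∷ A) ∨ insertZero P' B ∋₁ (false ∷ A)))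
    bw A t = ∧-intro (let (v , x) = IsPartition.nonempty pp A t in nonemptyᵇ-intro A v x) h
      where
      h : T (insertZero P' B ∋₁ (true ∷ A) ∨ insertZero P' B ∋₁ (false ∷ A))
      h with T-dec (vecEqᵇ A B)
      ... | inj₁ e = ∨-introˡ (subst T (sym (∋-insertZero P' B (true ∷ A))) e)
      ... | inj₂ ne' = ∨-introʳ {insertZero P' B ∋₁ (true ∷ A)} (subst T (sym (∋-insertZero P' B (false ∷ A))) (∧-intro t ne'))

  blockOfZero-insertZero : ∀ P' B → IsPartition n P' → Insertable P' B → blockOfZero (insertZero P' B) ≡ B
  blockOfZero-insertZero P' B pp bok = cong tail (blockOf-unique (insertZero P' B) (IsPartition.disjoint (insertZero-isPartition P' B pp bok)) (true ∷ B) zero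
                      (subst T (sym (∋-insertZero P' B (true ∷ B))) (vecEqᵇ-refl B)) tt)

  #blocks-insertZero : ∀ P' B → #blocks {suc n} (insertZero P' B) ≡ ⟦ not (P' ∋₀ B) ⟧ + #blocks {n} P'
  #blocks-insertZero P' B = begin
    #blocks {suc n} (insertZero P' B)  ≡⟨ count-cong (subsetType (suc n)) (∋-insertZero P' B) ⟩
    count (subsetType n) (λ A → vecEqᵇ A B) + others
                                       ≡⟨ cong (_+ others) (count-∧-eqᵇ (subsetType n) (λ _ → true) B) ⟩
    1 + others                         ≡⟨ cong (_+ others) (⟦not⟧+⟦⟧ (P' ∋₀ B)) ⟩
    (⟦ not (P' ∋₀ B) ⟧ + ⟦ P' ∋₀ B ⟧) + others
                                       ≡⟨ NP.+-assoc ⟦ not (P' ∋₀ B) ⟧ _ _ ⟩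
    ⟦ not (P' ∋₀ B) ⟧ + (⟦ P' ∋₀ B ⟧ + others)
                                       ≡⟨ cong (⟦ not (P' ∋₀ B) ⟧ +_) (sym #blocks-split) ⟩
    ⟦ not (P' ∋₀ B) ⟧ + #blocks {n} P'  ∎
    where
    open ≡-Reasoning
    others : ℕ
    others = count (subsetType n) (λ A → P' ∋₀ A ∧ not (vecEqᵇ A B))
    #blocks-split : #blocks {n} P' ≡ ⟦ P' ∋₀ B ⟧ + others
    #blocks-split = trans (count-split (subsetType n) (P' ∋₀_) (λ A → vecEqᵇ A B))
                          (cong (_+ others) (count-∧-eqᵇ (subsetType n) (P' ∋₀_) B))

-- Partitions coarser than an equivalence relation: the Stirling recurrence

Equiv : ∀ {m} → (Fin m → Fin m → Bool) → Set
Equiv E = IsEquivalence (λ u v → T (E u v))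

dropZero : ∀ {n} → (Fin (suc n) → Fin (suc n) → Bool) → Fin n → Fin n → Bool
dropZero E u v = E (suc u) (suc v)

dropZero-isEquivalence : ∀ {n} {E : Fin (suc n) → Fin (suc n) → Bool} → Equiv E → Equiv (dropZero E)
dropZero-isEquivalence eqv = record { refl = λ {u} → IsEquivalence.refl eqv {suc u} ; sym = IsEquivalence.sym eqv ; trans = IsEquivalence.trans eqv }

coarsePartitions : ∀ m → ℕ → (Fin m → Fin m → Bool) → ℕ
coarsePartitions m r E = count (subsetType (#subsets m)) (λ P → isPartitionIntoᵇ {m} r P ∧ coarsensᵇ {m} E P)

classCount : ∀ {m} → (Fin m → Fin m → Bool) → ℕ
classCount E = countF (λ v → not (anyF (λ w → (w <F v) ∧ E w v)))

count-pos : ∀ {X} (XT : FiniteType X) (p : X → Bool) x → T (p x) → Σ ℕ λ k → count XT p ≡ suc k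
count-pos XT p x px = others , trans (count-split XT p (λ y → eqᵇ XT y x))
                                      (cong (_+ others) (trans (count-∧-eqᵇ XT p x) (cong ⟦_⟧ (T⇒≡true px))))
  where
  others = count XT (λ y → p y ∧ not (eqᵇ XT y x))

module CoarsePartitionRecurrence (n : ℕ) (E : Fin (suc n) → Fin (suc n) → Bool) (eqv : Equiv E) where
  open ZeroDeletion n
  E' = dropZero E

  deleteZero-coarsens : ∀ P → Coarsens {suc n} E P → Coarsens {n} E' (deleteZero P)
  deleteZero-coarsens P c u v e with c (suc u) (suc v) e
  ... | (x ∷ A , a , ua , va) = A , subst T (sym (∋-deleteZero P A)) (∧-intro (nonemptyᵇ-intro A u ua) (h x a)) , ua , va
      where
      h : ∀ x → T (P ∋₁ (x ∷ A)) → T (P ∋₁ (true ∷ A) ∨ P ∋₁ (false ∷ A))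
      h true t = ∨-introˡ t
      h false t = ∨-introʳ {P ∋₁ (true ∷ A)} t

  insertZero-coarsens : ∀ P' B → IsPartition n P' → Insertable P' B → Coarsens {n} E' P' →
       (∀ v → T (E zero (suc v)) → T (mem v B)) → Coarsens {suc n} E (insertZero P' B)
  insertZero-coarsens P' B pp bok c hB = cc
    where
    tB : T (insertZero P' B ∋₁ (true ∷ B))
    tB = subst T (sym (∋-insertZero P' B (true ∷ B))) (vecEqᵇ-refl B)
    cc : Coarsens {suc n} E (insertZero P' B)
    cc zero zero e = true ∷ B , tB , tt , tt
    cc zero (suc v) e = true ∷ B , tB , tt , hB v e
    cc (suc u) zero e = true ∷ B , tB , hB u (IsEquivalence.sym eqv e) , tt
    cc (suc u) (suc v) e with c u v e
    ... | (A , a , ua , va) with T-dec (vecEqᵇ A B)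
    ... | inj₁ x = true ∷ A , subst T (sym (∋-insertZero P' B (true ∷ A))) x , ua , va
    ... | inj₂ y = false ∷ A , subst T (sym (∋-insertZero P' B (false ∷ A))) (∧-intro a y) , ua , va

  coarseᵇ₁ : ℕ → Vec Bool (#subsets (suc n)) → Bool
  coarseᵇ₁ r P = isPartitionIntoᵇ {suc n} r P ∧ coarsensᵇ {suc n} E P
  coarseᵇ₀ : ℕ → Vec Bool (#subsets n) → Bool
  coarseᵇ₀ r P' = isPartitionIntoᵇ {n} r P' ∧ coarsensᵇ {n} E' P'

  coarseᵇ₁-elim : ∀ r P → T (coarseᵇ₁ r P) → IsPartitionInto (suc n) r P × Coarsens {suc n} E P
  coarseᵇ₁-elim r P t = isPartitionIntoᵇ-sound r P (∧-elimˡ t) , coarsensᵇ-sound E P (∧-elimʳ {isPartitionIntoᵇ {suc n} r P} t)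
  coarseᵇ₁-intro : ∀ r P → IsPartitionInto (suc n) r P → Coarsens {suc n} E P → T (coarseᵇ₁ r P)
  coarseᵇ₁-intro r P pp c = ∧-intro (isPartitionIntoᵇ-complete r P pp) (coarsensᵇ-complete E P c)
  coarseᵇ₀-elim : ∀ r P → T (coarseᵇ₀ r P) → IsPartitionInto n r P × Coarsens {n} E' P
  coarseᵇ₀-elim r P t = isPartitionIntoᵇ-sound r P (∧-elimˡ t) , coarsensᵇ-sound E' P (∧-elimʳ {isPartitionIntoᵇ {n} r P} t)
  coarseᵇ₀-intro : ∀ r P → IsPartitionInto n r P → Coarsens {n} E' P → T (coarseᵇ₀ r P)
  coarseᵇ₀-intro r P pp c = ∧-intro (isPartitionIntoᵇ-complete r P pp) (coarsensᵇ-complete E' P c)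

  #blocks-deleteZero : ∀ P → IsPartition (suc n) P → #blocks {suc n} P ≡ ⟦ not (deleteZero P ∋₀ (blockOfZero P)) ⟧ + #blocks {n} (deleteZero P)
  #blocks-deleteZero P pp = trans (cong (#blocks {suc n}) (insertZero-deleteZero P pp)) (#blocks-insertZero (deleteZero P) (blockOfZero P))

  blockOfZero-∈-deleteZero : ∀ P → IsPartition (suc n) P → T (nonemptyᵇ (blockOfZero P)) → T (deleteZero P ∋₀ (blockOfZero P))
  blockOfZero-∈-deleteZero P pp t = subst T (sym (∋-deleteZero P (blockOfZero P))) (∧-intro t (∨-introˡ (∋-blockOfZero P pp)))

  blockOfZero-∉-deleteZero : ∀ P → IsPartition (suc n) P → T (not (nonemptyᵇ (blockOfZero P))) → T (not (deleteZero P ∋₀ (blockOfZero P)))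
  blockOfZero-∉-deleteZero P pp t = not-intro (λ x → not-elim t (∧-elimˡ (subst T (∋-deleteZero P (blockOfZero P)) x)))


  zeroNotAloneᵇ : Vec Bool (#subsets (suc n)) → Bool
  zeroNotAloneᵇ P = nonemptyᵇ (blockOfZero P)

  -- 0 shares its block with v0, so deleting 0 is a bijection that keeps the number of blocks.
  module ZeroRelated (v0 : Fin n) (e0 : T (E zero (suc v0))) (r : ℕ) where

    v0∈blockOfZero : ∀ P → IsPartition (suc n) P → Coarsens {suc n} E P → T (mem v0 (blockOfZero P))
    v0∈blockOfZero P pp c with c zero (suc v0) e0
    ... | (A , a , za , va) = subst (λ z → T (mem (suc v0) z)) (sym e) va
      where
      e : true ∷ blockOfZero P ≡ A
      e = IsPartition.disjoint pp (true ∷ blockOfZero P) A zero (∋-blockOfZero P pp) a tt za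

    insertWithV0 : Vec Bool (#subsets n) → Vec Bool (#subsets (suc n))
    insertWithV0 P' = insertZero P' (blockOf v0 P')

    blockOf-v0-∈ : ∀ P' → IsPartition n P' → T (P' ∋₀ (blockOf v0 P'))
    blockOf-v0-∈ P' pp = let (A , a , va) = IsPartition.covers pp v0 in subst (λ z → T (P' ∋₀ z)) (sym (blockOf-unique P' (IsPartition.disjoint pp) A v0 a va)) a

    Fq : ∀ P → T (coarseᵇ₁ r P) → T (coarseᵇ₀ r (deleteZero P))
    Fq P t = coarseᵇ₀-intro r (deleteZero P) (deleteZero-isPartition P pp , cd') (deleteZero-coarsens P c)
      where
      pp = proj₁ (proj₁ (coarseᵇ₁-elim r P t))
      c = proj₂ (coarseᵇ₁-elim r P t)
      inB = blockOfZero-∈-deleteZero P pp (nonemptyᵇ-intro (blockOfZero P) v0 (v0∈blockOfZero P pp c))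
      cd' : #blocks {n} (deleteZero P) ≡ r
      cd' = trans (sym (cong (λ z → ⟦ not z ⟧ + #blocks {n} (deleteZero P)) (T⇒≡true inB))) (trans (sym (#blocks-deleteZero P pp)) (proj₂ (proj₁ (coarseᵇ₁-elim r P t))))

    Gp : ∀ P' → T (coarseᵇ₀ r P') → T (coarseᵇ₁ r (insertWithV0 P'))
    Gp P' t = coarseᵇ₁-intro r (insertWithV0 P') (insertZero-isPartition P' B pp (inj₁ bin) , cd') (insertZero-coarsens P' B pp (inj₁ bin) c hB)
      where
      pp = proj₁ (proj₁ (coarseᵇ₀-elim r P' t))
      c = proj₂ (coarseᵇ₀-elim r P' t)
      B = blockOf v0 P'
      bin = blockOf-v0-∈ P' pp
      cd' : #blocks {suc n} (insertWithV0 P') ≡ r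
      cd' = trans (#blocks-insertZero P' B) (trans (cong (λ z → ⟦ not z ⟧ + #blocks {n} P') (T⇒≡true bin)) (proj₂ (proj₁ (coarseᵇ₀-elim r P' t))))
      hB : ∀ v → T (E zero (suc v)) → T (mem v B)
      hB v e with c v0 v (IsEquivalence.trans eqv (IsEquivalence.sym eqv e0) e)
      ... | (A , a , v0a , va) = subst (λ z → T (mem v z)) (sym (blockOf-unique P' (IsPartition.disjoint pp) A v0 a v0a)) va

    GF : ∀ P → T (coarseᵇ₁ r P) → insertWithV0 (deleteZero P) ≡ P
    GF P t = trans (cong (insertZero (deleteZero P)) (blockOf-unique (deleteZero P) (IsPartition.disjoint (deleteZero-isPartition P pp)) (blockOfZero P) v0 inB (v0∈blockOfZero P pp c))) (sym (insertZero-deleteZero P pp))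
      where
      pp = proj₁ (proj₁ (coarseᵇ₁-elim r P t))
      c = proj₂ (coarseᵇ₁-elim r P t)
      inB = blockOfZero-∈-deleteZero P pp (nonemptyᵇ-intro (blockOfZero P) v0 (v0∈blockOfZero P pp c))

    FG : ∀ P' → T (coarseᵇ₀ r P') → deleteZero (insertWithV0 P') ≡ P'
    FG P' t = deleteZero-insertZero P' (blockOf v0 P') pp (inj₁ (blockOf-v0-∈ P' pp))
      where pp = proj₁ (proj₁ (coarseᵇ₀-elim r P' t))

    coarsePartitions-zeroRelated : coarsePartitions (suc n) r E ≡ coarsePartitions n r E'
    coarsePartitions-zeroRelated = count-bijection (subsetType (#subsets (suc n))) (subsetType (#subsets n)) (coarseᵇ₁ r) (coarseᵇ₀ r) (λ P _ → deleteZero P) (λ P' _ → insertWithV0 P')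
                 Fq Gp (λ P pP _ → GF P pP) (λ P' qP _ → FG P' qP)

  -- Either {0} is a block, or 0 was added to one of the r blocks of a partition of the rest:
  -- S(n + 1, r + 1) = (r + 1) S(n, r + 1) + S(n, r).
  module ZeroIsolated (iso : ∀ v → T (E zero (suc v)) → ⊥) where

    vacuouslyInBlock : ∀ B v → T (E zero (suc v)) → T (mem v B)
    vacuouslyInBlock B v e = ⊥-elim (iso v e)

    XT = subsetType (#subsets (suc n))
    YT = subsetType (#subsets n)
    ∅ = replicate n false

    ¬nonemptyᵇ-∅ : T (nonemptyᵇ ∅) → ⊥
    ¬nonemptyᵇ-∅ t = let (v , x) = nonemptyᵇ-elim ∅ t in ∉-empty v x

    coarsePartitions-zeroBlocks : coarsePartitions (suc n) 0 E ≡ 0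
    coarsePartitions-zeroBlocks = count-none XT (coarseᵇ₁ 0) h
      where
      h : ∀ P → T (coarseᵇ₁ 0 P) → ⊥
      h P t with count-pos (subsetType (suc n)) (P ∋₁_) (true ∷ blockOfZero P) (∋-blockOfZero P (proj₁ (proj₁ (coarseᵇ₁-elim 0 P t))))
      ... | (k , e) with trans (sym e) (proj₂ (proj₁ (coarseᵇ₁-elim 0 P t)))
      ... | ()

    module ZeroAlone (r : ℕ) where
      zeroAloneᶜ : Vec Bool (#subsets (suc n)) → Bool
      zeroAloneᶜ P = coarseᵇ₁ (suc r) P ∧ not (zeroNotAloneᵇ P)

      insertAlone : Vec Bool (#subsets n) → Vec Bool (#subsets (suc n))
      insertAlone P' = insertZero P' ∅

      Fq : ∀ P → T (zeroAloneᶜ P) → T (coarseᵇ₀ r (deleteZero P))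
      Fq P t = coarseᵇ₀-intro r (deleteZero P) (deleteZero-isPartition P pp , cd') (deleteZero-coarsens P c)
        where
        pc = coarseᵇ₁-elim (suc r) P (∧-elimˡ t)
        pp = proj₁ (proj₁ pc)
        c = proj₂ pc
        nin = blockOfZero-∉-deleteZero P pp (∧-elimʳ {coarseᵇ₁ (suc r) P} t)
        cd' : #blocks {n} (deleteZero P) ≡ r
        cd' = NP.suc-injective (trans (sym (cong (λ z → ⟦ not z ⟧ + #blocks {n} (deleteZero P)) (¬T⇒≡false (not-elim nin))))
                                       (trans (sym (#blocks-deleteZero P pp)) (proj₂ (proj₁ pc))))

      Gp : ∀ P' → T (coarseᵇ₀ r P') → T (zeroAloneᶜ (insertAlone P'))
      Gp P' t = ∧-intro (coarseᵇ₁-intro (suc r) (insertAlone P') (insertZero-isPartition P' ∅ pp (inj₂ refl) , cd') (insertZero-coarsens P' ∅ pp (inj₂ refl) c (vacuouslyInBlock ∅)))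
                        (subst (λ z → T (not (nonemptyᵇ z))) (sym (blockOfZero-insertZero P' ∅ pp (inj₂ refl))) (not-intro ¬nonemptyᵇ-∅))
        where
        qc = coarseᵇ₀-elim r P' t
        pp = proj₁ (proj₁ qc)
        c = proj₂ qc
        nin : (P' ∋₀ ∅) ≡ false
        nin = ¬T⇒≡false (λ x → let (v , y) = IsPartition.nonempty pp ∅ x in ∉-empty v y)
        cd' : #blocks {suc n} (insertAlone P') ≡ suc r
        cd' = trans (#blocks-insertZero P' ∅) (trans (cong (λ z → ⟦ not z ⟧ + #blocks {n} P') nin) (cong suc (proj₂ (proj₁ qc))))

      GF : ∀ P → T (zeroAloneᶜ P) → insertAlone (deleteZero P) ≡ P
      GF P t = trans (cong (insertZero (deleteZero P)) (sym (¬nonemptyᵇ⇒empty (blockOfZero P) (∧-elimʳ {coarseᵇ₁ (suc r) P} t)))) (sym (insertZero-deleteZero P pp))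
        where pp = proj₁ (proj₁ (coarseᵇ₁-elim (suc r) P (∧-elimˡ t)))

      FG : ∀ P' → T (coarseᵇ₀ r P') → deleteZero (insertAlone P') ≡ P'
      FG P' t = deleteZero-insertZero P' ∅ (proj₁ (proj₁ (coarseᵇ₀-elim r P' t))) (inj₂ refl)

      count-zeroAlone : count XT zeroAloneᶜ ≡ coarsePartitions n r E'
      count-zeroAlone = count-bijection XT YT zeroAloneᶜ (coarseᵇ₀ r) (λ P _ → deleteZero P) (λ P' _ → insertAlone P') Fq Gp (λ P pP _ → GF P pP) (λ P' qP _ → FG P' qP)

    module ZeroNotAlone (r : ℕ) where
      zeroNotAloneᶜ : Vec Bool (#subsets (suc n)) → Bool
      zeroNotAloneᶜ P = coarseᵇ₁ r P ∧ zeroNotAloneᵇ P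

      Fq : ∀ P → T (zeroNotAloneᶜ P) → T (coarseᵇ₀ r (deleteZero P))
      Fq P t = coarseᵇ₀-intro r (deleteZero P) (deleteZero-isPartition P pp , cd') (deleteZero-coarsens P c)
        where
        pc = coarseᵇ₁-elim r P (∧-elimˡ t)
        pp = proj₁ (proj₁ pc)
        c = proj₂ pc
        inB = blockOfZero-∈-deleteZero P pp (∧-elimʳ {coarseᵇ₁ r P} t)
        cd' : #blocks {n} (deleteZero P) ≡ r
        cd' = trans (sym (cong (λ z → ⟦ not z ⟧ + #blocks {n} (deleteZero P)) (T⇒≡true inB))) (trans (sym (#blocks-deleteZero P pp)) (proj₂ (proj₁ pc)))

      fb : Vec Bool (#subsets n) → Vec Bool (#subsets (suc n)) → Bool
      fb P' P = inFibre XT YT (zeroNotAloneᶜ P) (λ _ → deleteZero P) P'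

      count-fibre : ∀ P' → count XT (fb P') ≡ r * ⟦ coarseᵇ₀ r P' ⟧
      count-fibre P' with T-dec (coarseᵇ₀ r P')
      ... | inj₂ nq = trans (count-none XT (fb P') h) (sym (trans (cong (λ z → r * ⟦ z ⟧) (¬T⇒≡false (not-elim nq))) (NP.*-zeroʳ r)))
        where
        h : ∀ P → T (fb P' P) → ⊥
        h P t = let (pP , e) = inFibre-elim XT YT (zeroNotAloneᶜ P) (λ _ → deleteZero P) P' t in
                not-elim nq (subst (λ z → T (coarseᵇ₀ r z)) e (Fq P pP))
      ... | inj₁ qP = trans (count-bijection XT (subsetType n) (fb P') (P' ∋₀_) F' G' F'q G'p G'F F'G)
                            (trans (proj₂ (proj₁ qc)) (sym (trans (cong (λ z → r * ⟦ z ⟧) (T⇒≡true qP)) (NP.*-identityʳ r))))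
        where
        qc = coarseᵇ₀-elim r P' qP
        pp' = proj₁ (proj₁ qc)
        F' : ∀ P → T (fb P' P) → Vec Bool n
        F' P _ = blockOfZero P
        G' : ∀ A → T (P' ∋₀ A) → Vec Bool (#subsets (suc n))
        G' A _ = insertZero P' A
        F'q : ∀ P t → T (P' ∋₀ (F' P t))
        F'q P t = let (pP , e) = inFibre-elim XT YT (zeroNotAloneᶜ P) (λ _ → deleteZero P) P' t
                      pp = proj₁ (proj₁ (coarseᵇ₁-elim r P (∧-elimˡ pP))) in
                  subst (λ z → T (z ∋₀ (blockOfZero P))) e (blockOfZero-∈-deleteZero P pp (∧-elimʳ {coarseᵇ₁ r P} pP))
        G'p : ∀ A a → T (fb P' (G' A a))
        G'p A a = inFibre-intro XT YT (zeroNotAloneᶜ (insertZero P' A)) (λ _ → deleteZero (insertZero P' A)) P' pc (deleteZero-insertZero P' A pp' (inj₁ a))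
          where
          cd' : #blocks {suc n} (insertZero P' A) ≡ r
          cd' = trans (#blocks-insertZero P' A) (trans (cong (λ z → ⟦ not z ⟧ + #blocks {n} P') (T⇒≡true a)) (proj₂ (proj₁ qc)))
          ne' : T (zeroNotAloneᵇ (insertZero P' A))
          ne' = let (v , x) = IsPartition.nonempty pp' A a in subst (λ z → T (nonemptyᵇ z)) (sym (blockOfZero-insertZero P' A pp' (inj₁ a))) (nonemptyᵇ-intro A v x)
          pc : T (zeroNotAloneᶜ (insertZero P' A))
          pc = ∧-intro (coarseᵇ₁-intro r (insertZero P' A) (insertZero-isPartition P' A pp' (inj₁ a) , cd') (insertZero-coarsens P' A pp' (inj₁ a) (proj₂ qc) (vacuouslyInBlock A))) ne'
        G'F : ∀ P t a → G' (F' P t) a ≡ P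
        G'F P t a = let (pP , e) = inFibre-elim XT YT (zeroNotAloneᶜ P) (λ _ → deleteZero P) P' t
                        pp = proj₁ (proj₁ (coarseᵇ₁-elim r P (∧-elimˡ pP))) in
                    trans (cong (λ z → insertZero z (blockOfZero P)) (sym e)) (sym (insertZero-deleteZero P pp))
        F'G : ∀ A a t → F' (G' A a) t ≡ A
        F'G A a t = blockOfZero-insertZero P' A pp' (inj₁ a)

      count-zeroNotAlone : count XT zeroNotAloneᶜ ≡ r * coarsePartitions n r E'
      count-zeroNotAlone = trans (count-fibres XT YT zeroNotAloneᶜ (λ P _ → deleteZero P))
                     (trans (sum-cong (summation YT) ℕ+ count-fibre) (sum-*ˡ YT r (λ P' → ⟦ coarseᵇ₀ r P' ⟧)))

    coarsePartitions-zeroIsolated : ∀ r → coarsePartitions (suc n) (suc r) E ≡ suc r * coarsePartitions n (suc r) E' + coarsePartitions n r E'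
    coarsePartitions-zeroIsolated r = trans (count-split XT (coarseᵇ₁ (suc r)) zeroNotAloneᵇ) (cong₂ _+_ (ZeroNotAlone.count-zeroNotAlone (suc r)) (ZeroAlone.count-zeroAlone r))

<F-irr : ∀ {m} (i : Fin m) → T (i <F i) → ⊥
<F-irr zero ()
<F-irr (suc i) t = <F-irr i t

<F-tri : ∀ {m} (i j : Fin m) → T (i <F j) ⊎ (i ≡ j) ⊎ T (j <F i)
<F-tri zero zero = inj₂ (inj₁ refl)
<F-tri zero (suc j) = inj₁ tt
<F-tri (suc i) zero = inj₂ (inj₂ tt)
<F-tri (suc i) (suc j) with <F-tri i j
... | inj₁ x = inj₁ x
... | inj₂ (inj₁ e) = inj₂ (inj₁ (cong suc e))
... | inj₂ (inj₂ y) = inj₂ (inj₂ y)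

leastWitness : ∀ {m} (p : Fin m → Bool) i → T (p i) → Σ (Fin m) λ j → T (p j) × (∀ k → T (k <F j) → T (p k) → ⊥)
leastWitness {suc m} p i t with T-dec (p zero)
... | inj₁ x = zero , x , h
  where h : ∀ k → T (k <F zero) → T (p k) → ⊥
        h zero () _
        h (suc k) () _
leastWitness {suc m} p zero t | inj₂ y = ⊥-elim (not-elim y t)
leastWitness {suc m} p (suc i) t | inj₂ y with leastWitness (λ k → p (suc k)) i t
... | (j , pj , minimal) = suc j , pj , h
  where h : ∀ k → T (k <F suc j) → T (p k) → ⊥
        h zero _ pk = not-elim y pk
        h (suc k) lt pk = minimal k lt pk

anyF-cong : ∀ {m} {p q : Fin m → Bool} → (∀ i → p i ≡ q i) → anyF p ≡ anyF q
anyF-cong {p = p} {q} e = T⇔T⇒≡ (λ t → let (i , x) = anyF-elim {p = p} t in anyF-intro {p = q} i (subst T (e i) x))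
                                   (λ t → let (i , x) = anyF-elim {p = q} t in anyF-intro {p = p} i (subst T (sym (e i)) x))

anyF-false : ∀ {m} (p : Fin m → Bool) → (∀ i → T (p i) → ⊥) → anyF p ≡ false
anyF-false p f = ¬T⇒≡false (λ t → let (i , x) = anyF-elim {p = p} t in f i x)

countF-cong : ∀ {m} {p q : Fin m → Bool} → (∀ i → p i ≡ q i) → countF p ≡ countF q
countF-cong {m} {p} {q} e = trans (countF≡count p) (trans (count-cong (finType m) e) (sym (countF≡count q)))

module ClassCount (n : ℕ) (E : Fin (suc n) → Fin (suc n) → Bool) (eqv : Equiv E) where
  E' = dropZero E
  smallerRelated : Fin n → Bool
  smallerRelated v = anyF (λ w → (w <F v) ∧ E' w v)

  classCount-unfold : classCount E ≡ suc (countF (λ v → not (E zero (suc v) ∨ smallerRelated v)))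
  classCount-unfold = cong (λ z → ⟦ not z ⟧ + countF (λ v → not (E zero (suc v) ∨ smallerRelated v)))
                 (anyF-false (λ w → (suc w <F zero) ∧ E (suc w) zero) (λ w ()))

  classCount-zeroIsolated : (∀ v → T (E zero (suc v)) → ⊥) → classCount E ≡ suc (classCount E')
  classCount-zeroIsolated iso = trans classCount-unfold (cong suc (countF-cong (λ v → cong (λ z → not (z ∨ smallerRelated v)) (¬T⇒≡false (iso v)))))

  -- 0 represents its class of E; in E' that class is represented by the least v with 0 ~ suc v,
  -- and every other vertex keeps its status.
  classCount-zeroRelated : ∀ v0 → T (E zero (suc v0)) → classCount E ≡ classCount E'
  classCount-zeroRelated v0 e0 = trans classCount-unfold (sym (trans (countF≡count (λ v → not (smallerRelated v)))
                  (trans (count-split (finType n) (λ v → not (smallerRelated v)) (λ v → E zero (suc v)))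
                  (cong₂ _+_ one (trans (count-cong (finType n) (λ v → h (smallerRelated v) (E zero (suc v)))) (sym (countF≡count (λ v → not (E zero (suc v) ∨ smallerRelated v)))))))))
    where
    h : ∀ a b → (not a ∧ not b) ≡ not (b ∨ a)
    h true true = refl
    h true false = refl
    h false true = refl
    h false false = refl
    leastRelated = leastWitness (λ v → E zero (suc v)) v0 e0
    least = proj₁ leastRelated
    0~least = proj₁ (proj₂ leastRelated)
    least-minimal = proj₂ (proj₂ leastRelated)
    pt : ∀ v → (not (smallerRelated v) ∧ E zero (suc v)) ≡ (least ==F v)
    pt v = T⇔T⇒≡ fw bw
      where
      fw : T (not (smallerRelated v) ∧ E zero (suc v)) → T (least ==F v)
      fw t with <F-tri least v
      ... | inj₂ (inj₁ e) = subst (λ z → T (least ==F z)) e (==F-refl least)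
      ... | inj₂ (inj₂ lt) = ⊥-elim (least-minimal v lt (∧-elimʳ {not (smallerRelated v)} t))
      ... | inj₁ lt = ⊥-elim (not-elim (∧-elimˡ t) (anyF-intro {p = λ w → (w <F v) ∧ E' w v} least
                         (∧-intro lt (IsEquivalence.trans eqv (IsEquivalence.sym eqv 0~least) (∧-elimʳ {not (smallerRelated v)} t)))))
      bw : T (least ==F v) → T (not (smallerRelated v) ∧ E zero (suc v))
      bw t = subst (λ z → T (not (smallerRelated z) ∧ E zero (suc z))) (==F-≡ t)
               (∧-intro (not-intro (λ x → let (w , y) = anyF-elim {p = λ w → (w <F least) ∧ E' w least} x in
                          least-minimal w (∧-elimˡ y) (IsEquivalence.trans eqv 0~least (IsEquivalence.sym eqv (∧-elimʳ {w <F least} y))))) 0~least)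
    one : count (finType n) (λ v → not (smallerRelated v) ∧ E zero (suc v)) ≡ 1
    one = trans (count-cong (finType n) pt) (count-delta (finType n) least)

coarsePartitions-0 : ∀ r (E : Fin 0 → Fin 0 → Bool) → coarsePartitions 0 r E ≡ stirling2 (classCount E) r
coarsePartitions-0 zero E = refl
coarsePartitions-0 (suc r) E = refl

coarsePartitions≡stirling2 : ∀ m (E : Fin m → Fin m → Bool) → Equiv E → ∀ r → coarsePartitions m r E ≡ stirling2 (classCount E) r
coarsePartitions≡stirling2 zero E eqv r = coarsePartitions-0 r E
coarsePartitions≡stirling2 (suc n) E eqv r with T-dec (anyF (λ v → E zero (suc v)))
... | inj₁ related = let (v0 , e0) = anyF-elim {p = λ v → E zero (suc v)} related in begin
    coarsePartitions (suc n) r E            ≡⟨ ZeroRelated.coarsePartitions-zeroRelated v0 e0 r ⟩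
    coarsePartitions n r (dropZero E)       ≡⟨ IH r ⟩
    stirling2 (classCount (dropZero E)) r   ≡⟨ cong (λ c → stirling2 c r) (sym (classCount-zeroRelated v0 e0)) ⟩
    stirling2 (classCount E) r              ∎
  where
  open CoarsePartitionRecurrence n E eqv
  open ClassCount n E eqv
  open ≡-Reasoning
  IH = coarsePartitions≡stirling2 n (dropZero E) (dropZero-isEquivalence eqv)
... | inj₂ unrelated = isolated r
  where
  isolated-zero : ∀ v → T (E zero (suc v)) → ⊥
  isolated-zero v e = not-elim unrelated (anyF-intro {p = λ v → E zero (suc v)} v e)
  open CoarsePartitionRecurrence n E eqv
  open ZeroIsolated isolated-zero
  open ≡-Reasoning
  IH = coarsePartitions≡stirling2 n (dropZero E) (dropZero-isEquivalence eqv)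
  classes = ClassCount.classCount-zeroIsolated n E eqv isolated-zero
  isolated : ∀ r → coarsePartitions (suc n) r E ≡ stirling2 (classCount E) r
  isolated zero = begin
    coarsePartitions (suc n) 0 E                 ≡⟨ coarsePartitions-zeroBlocks ⟩
    0                                            ≡⟨ cong (λ c → stirling2 c 0) (sym classes) ⟩
    stirling2 (classCount E) 0                   ∎
  isolated (suc r) = begin
    coarsePartitions (suc n) (suc r) E           ≡⟨ coarsePartitions-zeroIsolated r ⟩
    suc r * coarsePartitions n (suc r) (dropZero E) + coarsePartitions n r (dropZero E)
                                                 ≡⟨ cong₂ (λ a b → suc r * a + b) (IH (suc r)) (IH r) ⟩
    stirling2 (suc (classCount (dropZero E))) (suc r)
                                                 ≡⟨ cong (λ c → stirling2 c (suc r)) (sym classes) ⟩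
    stirling2 (classCount E) (suc r)             ∎

⟦⟧-mono : ∀ {a b} → (T a → T b) → ⟦ a ⟧ ≤ ⟦ b ⟧
⟦⟧-mono {true} {true} _ = s≤s z≤n
⟦⟧-mono {true} {false} f = ⊥-elim (f tt)
⟦⟧-mono {false} _ = z≤n

⟦⟧-injective : ∀ {a b} → ⟦ a ⟧ ≡ ⟦ b ⟧ → a ≡ b
⟦⟧-injective {true} {true} _ = refl
⟦⟧-injective {false} {false} _ = refl

countF-mono : ∀ {m} {p q : Fin m → Bool} → (∀ i → T (p i) → T (q i)) → countF p ≤ countF q
countF-mono {zero} f = z≤n
countF-mono {suc m} f = NP.+-mono-≤ (⟦⟧-mono (f zero)) (countF-mono {m} (λ i → f (suc i)))

countF-bound : ∀ {m} (p : Fin m → Bool) → countF p ≤ m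
countF-bound {zero} p = z≤n
countF-bound {suc m} p = NP.+-mono-≤ (⟦⟧-mono {b = true} (λ _ → tt)) (countF-bound (λ i → p (suc i)))

+-≡-≤⇒≡ : ∀ {a b c d} → a ≤ b → c ≤ d → a + c ≡ b + d → a ≡ b
+-≡-≤⇒≡ a≤b c≤d e with NP.m≤n⇒m<n∨m≡n a≤b
... | inj₂ a≡b = a≡b
... | inj₁ a<b = ⊥-elim (NP.<-irrefl e (NP.+-mono-<-≤ a<b c≤d))

countF-≡⇒head-≡ : ∀ {m} {p q : Fin (suc m) → Bool} → (∀ i → T (p i) → T (q i)) → countF p ≡ countF q → ⟦ p zero ⟧ ≡ ⟦ q zero ⟧
countF-≡⇒head-≡ f e = +-≡-≤⇒≡ (⟦⟧-mono (f zero)) (countF-mono (λ i → f (suc i))) e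

countF-≡⇒≗ : ∀ {m} {p q : Fin m → Bool} → (∀ i → T (p i) → T (q i)) → countF p ≡ countF q → ∀ i → p i ≡ q i
countF-≡⇒≗ {suc m} {p} {q} f e zero = ⟦⟧-injective (countF-≡⇒head-≡ f e)
countF-≡⇒≗ {suc m} {p} {q} f e (suc i) = countF-≡⇒≗ (λ i → f (suc i)) tails-≡ i
  where
  tails-≡ : countF (λ i → p (suc i)) ≡ countF (λ i → q (suc i))
  tails-≡ = NP.+-cancelˡ-≡ ⟦ q zero ⟧ _ _ (trans (cong (_+ countF (λ i → p (suc i))) (sym (countF-≡⇒head-≡ f e))) e)
countF-pos : ∀ {m} (p : Fin m → Bool) {k} → countF p ≡ suc k → Σ (Fin m) λ i → T (p i)
countF-pos {zero} p ()
countF-pos {suc m} p e with p zero in p0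
... | true = zero , subst T (sym p0) tt
... | false with countF-pos (λ i → p (suc i)) e
... | (i , x) = suc i , x

countF-delta : ∀ {m} (i : Fin m) → countF (λ j → i ==F j) ≡ 1
countF-delta {suc m} zero = cong suc (h m)
  where h : ∀ m → countF {m} (λ j → false) ≡ 0
        h zero = refl
        h (suc m) = h m
countF-delta {suc m} (suc i) = countF-delta i

module Connectivity {n : ℕ} (K : SimplicialComplex n) (s : ℕ) where
  m = mFs K s
  σ = simplex K s
  rI = reachIn K s
  sC = sameComp K s

  meets-sym : ∀ (A B : Vec Bool n) → meetsB A B ≡ meetsB B A
  meets-sym A B = anyF-cong (λ v → ∧-comm (mem v A) (mem v B))

  adj-sym : ∀ S l j → T (adj K s S l j) → T (adj K s S j l)
  adj-sym S l j t = ∧-intro {mem j S} {mem l S ∧ meetsB (σ j) (σ l)} (∧-elimˡ {mem j S} (∧-elimʳ {mem l S} t))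
                      (∧-intro {mem l S} {meetsB (σ j) (σ l)} (∧-elimˡ {mem l S} t) (subst T (meets-sym (σ l) (σ j)) (∧-elimʳ {mem j S} (∧-elimʳ {mem l S} t))))

  reachIn-mono : ∀ S d k i j → T (rI k S i j) → T (rI (d + k) S i j)
  reachIn-mono S zero k i j t = t
  reachIn-mono S (suc d) k i j t = ∨-introˡ (reachIn-mono S d k i j t)

  reachIn-step : ∀ S k i l j → T (rI k S i l) → T (adj K s S l j) → T (rI (suc k) S i j)
  reachIn-step S k i l j r a = ∨-introʳ {rI k S i j} (anyF-intro {p = λ x → rI k S i x ∧ adj K s S x j} l (∧-intro r a))

  reachIn-trans : ∀ S a b i j l → T (rI a S i j) → T (rI b S j l) → T (rI (b + a) S i l)
  reachIn-trans S a zero i j l r1 r2 = subst (λ z → T (rI a S i z)) (==F-≡ r2) r1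
  reachIn-trans S a (suc b) i j l r1 r2 with ∨-elim {rI b S j l} r2
  ... | inj₁ x = ∨-introˡ (reachIn-trans S a b i j l r1 x)
  ... | inj₂ y = let (x , z) = anyF-elim {p = λ x → rI b S j x ∧ adj K s S x l} y in
                 reachIn-step S (b + a) i x l (reachIn-trans S a b i j x r1 (∧-elimˡ z)) (∧-elimʳ {rI b S j x} z)

  module Stabilisation (S : Vec Bool m) (i : Fin m) where
    R : ℕ → Fin m → Bool
    R k = rI k S i
    c : ℕ → ℕ
    c k = countF (R k)

    Stable : ℕ → Set
    Stable k = ∀ j → R (suc k) j ≡ R k j

    step : ∀ k → Stable k → Stable (suc k)
    step k st j = T⇔T⇒≡ fw (λ t → ∨-introˡ t)
      where
      fw : T (R (suc (suc k)) j) → T (R (suc k) j)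
      fw t with ∨-elim {R (suc k) j} t
      ... | inj₁ x = x
      ... | inj₂ y = let (l , z) = anyF-elim {p = λ l → R (suc k) l ∧ adj K s S l j} y in
                     reachIn-step S k i l j (subst T (st l) (∧-elimˡ z)) (∧-elimʳ {R (suc k) l} z)

    -- Until R stabilises it gains an element at every step, and it has at most m elements.
    GrowingOrStable : ℕ → Set
    GrowingOrStable k = suc k ≤ c k ⊎ Stable k

    growingOrStable : ∀ k → GrowingOrStable k
    growingOrStable zero = inj₁ (NP.≤-reflexive (sym (countF-delta i)))
    growingOrStable (suc k) with growingOrStable k
    ... | inj₂ st = inj₂ (step k st)
    ... | inj₁ le with c k NP.≟ c (suc k)
    ... | yes e = inj₂ (step k (λ j → sym (countF-≡⇒≗ {m} (λ j t → ∨-introˡ t) e j)))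
    ... | no ne = inj₁ (NP.≤-trans (s≤s le) (NP.≤∧≢⇒< (countF-mono {m} (λ j t → ∨-introˡ t)) ne))

    stable-m : Stable m
    stable-m with growingOrStable m
    ... | inj₂ st = st
    ... | inj₁ le = ⊥-elim (NP.<-irrefl refl (NP.≤-trans le (countF-bound (R m))))

    stable-from-m : ∀ t → Stable (t + m)
    stable-from-m zero = stable-m
    stable-from-m (suc t) = step (t + m) (stable-from-m t)

    R-after-m : ∀ t j → R (t + m) j ≡ R m j
    R-after-m zero j = refl
    R-after-m (suc t) j = trans (stable-from-m t j) (R-after-m t j)

    R⇒R-m : ∀ k j → T (R k j) → T (R m j)
    R⇒R-m k j t = subst T (R-after-m k j) (subst (λ z → T (R z j)) (NP.+-comm m k) (reachIn-mono S m k i j t))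

  reachIn⇒sameComp : ∀ S k i j → T (rI k S i j) → T (sC S i j)
  reachIn⇒sameComp S k i j = Stabilisation.R⇒R-m S i k j

  sameComp-refl : ∀ S i → T (sC S i i)
  sameComp-refl S i = reachIn⇒sameComp S 0 i i (==F-refl i)

  sameComp-trans : ∀ S i j l → T (sC S i j) → T (sC S j l) → T (sC S i l)
  sameComp-trans S i j l a b = reachIn⇒sameComp S (m + m) i l (reachIn-trans S m m i j l a b)

  adj⇒sameComp : ∀ S i j → T (adj K s S i j) → T (sC S i j)
  adj⇒sameComp S i j a = reachIn⇒sameComp S 1 i j (reachIn-step S 0 i i j (==F-refl i) a)

  reachIn⇒sameComp-sym : ∀ S k i j → T (rI k S i j) → T (sC S j i)
  reachIn⇒sameComp-sym S zero i j t = subst (λ z → T (sC S z i)) (==F-≡ t) (sameComp-refl S i)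
  reachIn⇒sameComp-sym S (suc k) i j t with ∨-elim {rI k S i j} t
  ... | inj₁ x = reachIn⇒sameComp-sym S k i j x
  ... | inj₂ y = let (l , z) = anyF-elim {p = λ x → rI k S i x ∧ adj K s S x j} y in
                 sameComp-trans S j l i (adj⇒sameComp S j l (adj-sym S l j (∧-elimʳ {rI k S i l} z))) (reachIn⇒sameComp-sym S k i l (∧-elimˡ z))

  sameComp-sym : ∀ S i j → T (sC S i j) → T (sC S j i)
  sameComp-sym S i j = reachIn⇒sameComp-sym S m i j

  meet⇒sameComp : ∀ S i j v → T (mem i S) → T (mem j S) → T (mem v (σ i)) → T (mem v (σ j)) → T (sC S i j)
  meet⇒sameComp S i j v iS jS vi vj = adj⇒sameComp S i j (∧-intro iS (∧-intro jS (anyF-intro {p = λ v → mem v (σ i) ∧ mem v (σ j)} v (∧-intro vi vj))))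

_⊑_ : ∀ {n} → Vec Bool n → Vec Bool n → Set
A ⊑ B = ∀ v → T (mem v A) → T (mem v B)

subB-intro : ∀ {n} (A B : Vec Bool n) → A ⊑ B → T (subB A B)
subB-intro A B f = allF-intro {p = λ v → not (mem v A) ∨ mem v B} (λ v → h v (T-dec (mem v A)))
  where h : ∀ v → T (mem v A) ⊎ T (not (mem v A)) → T (not (mem v A) ∨ mem v B)
        h v (inj₁ x) = ∨-introʳ {not (mem v A)} (f v x)
        h v (inj₂ y) = ∨-introˡ y

subB-elim : ∀ {n} (A B : Vec Bool n) → T (subB A B) → A ⊑ B
subB-elim A B t v x with ∨-elim {not (mem v A)} (allF-elim {p = λ v → not (mem v A) ∨ mem v B} t v)
... | inj₁ y = ⊥-elim (not-elim y x)
... | inj₂ y = y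

lookup-filterᵇ : ∀ {A : Set} (p : A → Bool) (L : List A) i → T (p (List.lookup (filterᵇ p L) i))
lookup-filterᵇ p (x ∷ L) i with p x in px
lookup-filterᵇ p (x ∷ L) zero | true = subst T (sym px) tt
lookup-filterᵇ p (x ∷ L) (suc i) | true = lookup-filterᵇ p L i
... | false = lookup-filterᵇ p L i


module InsideBlocks {n : ℕ} (K : SimplicialComplex n) (s : ℕ) where
  open SimplicialComplex K
  open Connectivity K s public

  simplex-size : ∀ i → ∣ σ i ∣ ≡ suc s
  simplex-size i = ==ℕ-≡ (∧-elimʳ {face (σ i)} (lookup-filterᵇ (λ σ → face σ ∧ (∣ σ ∣ ==ℕ suc s)) (subsets n) i))

  simplex-nonempty : ∀ i → Σ (Fin n) λ v → T (mem v (σ i))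
  simplex-nonempty i = countF-pos (λ v → mem v (σ i)) (trans (sym (∣∣≡countF (σ i))) (simplex-size i))

  insideBlocks : Vec Bool (#subsets n) → Vec Bool m
  insideBlocks P = tabulate (λ i → anyF (λ b → mem b P ∧ subB (σ i) (subsetAt {n} b)))

  insideBlocks-intro : ∀ P i A → T (_∋_ {n} P A) → σ i ⊑ A → T (mem i (insideBlocks P))
  insideBlocks-intro P i A a f = subst T (sym (lookup∘tabulate _ i))
    (anyF-intro {p = λ b → mem b P ∧ subB (σ i) (subsetAt {n} b)} (indexOf {n} A)
       (∧-intro a (subst (λ z → T (subB (σ i) z)) (sym (subsetAt-indexOf {n} A)) (subB-intro (σ i) A f))))

  insideBlocks-elim : ∀ P i → T (mem i (insideBlocks P)) → Σ (Vec Bool n) λ A → T (_∋_ {n} P A) × σ i ⊑ A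
  insideBlocks-elim P i t = let (b , x) = anyF-elim {p = λ b → mem b P ∧ subB (σ i) (subsetAt {n} b)} (subst T (lookup∘tabulate _ i) t) in
    subsetAt {n} b , subst T (mem≡∋ {n} P b) (∧-elimˡ x) , subB-elim (σ i) (subsetAt {n} b) (∧-elimʳ {mem b P} x)

  reachIn-withinBlock : ∀ P → IsPartition n P → ∀ S → (∀ j → T (mem j S) → T (mem j (insideBlocks P))) →
         ∀ k i j A → T (_∋_ {n} P A) → σ i ⊑ A → T (rI k S i j) → σ j ⊑ A
  reachIn-withinBlock P pp S sub zero i j A a f t = subst (λ z → σ z ⊑ A) (==F-≡ t) f
  reachIn-withinBlock P pp S sub (suc k) i j A a f t with ∨-elim {rI k S i j} t
  ... | inj₁ x = reachIn-withinBlock P pp S sub k i j A a f x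
  ... | inj₂ y = g
    where
    lz = anyF-elim {p = λ l → rI k S i l ∧ adj K s S l j} y
    l = proj₁ lz
    z = proj₂ lz
    ad : T (adj K s S l j)
    ad = ∧-elimʳ {rI k S i l} z
    fl : σ l ⊑ A
    fl = reachIn-withinBlock P pp S sub k i l A a f (∧-elimˡ z)
    jS : T (mem j S)
    jS = ∧-elimˡ (∧-elimʳ {mem l S} ad)
    te = insideBlocks-elim P j (sub j jS)
    mt = anyF-elim {p = λ v → mem v (σ l) ∧ mem v (σ j)} (∧-elimʳ {mem j S} (∧-elimʳ {mem l S} ad))
    v = proj₁ mt
    e : proj₁ te ≡ A
    e = IsPartition.disjoint pp (proj₁ te) A v (proj₁ (proj₂ te)) a (proj₂ (proj₂ te) v (∧-elimʳ {mem v (σ l)} (proj₂ mt))) (fl v (∧-elimˡ (proj₂ mt)))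
    g : σ j ⊑ A
    g w x = subst (λ z → T (mem w z)) e (proj₂ (proj₂ te) w x)

  closedB-intro : ∀ C → (∀ j → subB (σ j) (V K s C) ≡ mem j C) → T (closedB K s C)
  closedB-intro C e = allF-intro {p = λ j → (subB (σ j) (V K s C) ∧ mem j C) ∨ (not (subB (σ j) (V K s C)) ∧ not (mem j C))}
                         (λ j → h (subB (σ j) (V K s C)) (mem j C) (e j))
    where h : ∀ a b → a ≡ b → T ((a ∧ b) ∨ (not a ∧ not b))
          h true .true refl = tt
          h false .false refl = tt

  mem-V : ∀ S v → mem v (V K s S) ≡ anyF (λ k → mem k S ∧ mem v (σ k))
  mem-V S v = lookup∘tabulate _ v

  mem-component : ∀ S i j → mem j (component K s S i) ≡ (mem j S ∧ sC S i j)
  mem-component S i j = lookup∘tabulate _ j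

  -- A simplex σ_j ⊆ V(C) meets C, so it lies in the component C; and V(C) lies in the block of
  -- σ_i, so σ_j is inside a block, i.e. j ∈ T_P.
  component-closed : ∀ P → IsPartition n P → ∀ i → T (mem i (insideBlocks P)) →
                     T (closedB K s (component K s (insideBlocks P) i))
  component-closed P pp i i∈TP = closedB-intro C (λ j → T⇔T⇒≡ (fw j) (bw j))
    where
    TP = insideBlocks P
    C = component K s TP i
    Ai = proj₁ (insideBlocks-elim P i i∈TP)
    Ai∈P = proj₁ (proj₂ (insideBlocks-elim P i i∈TP))
    σi⊑Ai = proj₂ (proj₂ (insideBlocks-elim P i i∈TP))
    bw : ∀ j → T (mem j C) → T (subB (σ j) (V K s C))
    bw j x = subB-intro (σ j) (V K s C) (λ v y → subst T (sym (mem-V C v))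
                (anyF-intro {p = λ k → mem k C ∧ mem v (σ k)} j (∧-intro x y)))
    inVC : ∀ v → T (mem v (V K s C)) → Σ (Fin m) λ k → T (mem k TP) × T (sC TP i k) × T (mem v (σ k))
    inVC v x = let (k , y) = anyF-elim {p = λ k → mem k C ∧ mem v (σ k)} (subst T (mem-V C v) x)
                   kc = subst T (mem-component TP i k) (∧-elimˡ y) in
               k , ∧-elimˡ kc , ∧-elimʳ {mem k TP} kc , ∧-elimʳ {mem k C} y
    fw : ∀ j → T (subB (σ j) (V K s C)) → T (mem j C)
    fw j x = subst T (sym (mem-component TP i j)) (∧-intro j∈TP (sameComp-trans TP i k j ik (meet⇒sameComp TP k j v0 kS j∈TP v0k v0j)))
      where
      σj⊑VC = subB-elim (σ j) (V K s C) x
      σj⊑Ai : σ j ⊑ Ai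
      σj⊑Ai v y = let (k , kS , ik , vk) = inVC v (σj⊑VC v y) in
                  reachIn-withinBlock P pp TP (λ _ z → z) m i k Ai Ai∈P σi⊑Ai ik v vk
      j∈TP : T (mem j TP)
      j∈TP = insideBlocks-intro P j Ai Ai∈P σj⊑Ai
      v0 = proj₁ (simplex-nonempty j)
      v0j = proj₂ (simplex-nonempty j)
      kk = inVC v0 (σj⊑VC v0 v0j)
      k = proj₁ kk
      kS = proj₁ (proj₂ kk)
      ik = proj₁ (proj₂ (proj₂ kk))
      v0k = proj₂ (proj₂ (proj₂ kk))

  insideBlocks∈L : ∀ P → IsPartition n P → T (inL K s (insideBlocks P))
  insideBlocks∈L P pp = allF-intro {p = λ i → not (mem i (insideBlocks P)) ∨ closedB K s (component K s (insideBlocks P) i)}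
                                   (λ i → by-membership i (T-dec (mem i (insideBlocks P))))
    where
    by-membership : ∀ i → T (mem i (insideBlocks P)) ⊎ T (not (mem i (insideBlocks P))) →
                    T (not (mem i (insideBlocks P)) ∨ closedB K s (component K s (insideBlocks P) i))
    by-membership i (inj₁ i∈TP) = ∨-introʳ {not (mem i (insideBlocks P))} (component-closed P pp i i∈TP)
    by-membership i (inj₂ i∉TP) = ∨-introˡ i∉TP

module PiPartition {n : ℕ} (K : SimplicialComplex n) (s : ℕ) where
  open InsideBlocks K s

  piRel : Vec Bool m → Fin n → Fin n → Bool
  piRel S u v = (u ==F v) ∨ anyF (λ i → anyF (λ j → mem i S ∧ mem j S ∧ mem u (σ i) ∧ mem v (σ j) ∧ sC S i j))

  record Linked (S : Vec Bool m) (u v : Fin n) : Set where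
    constructor lk
    field
      i j : Fin m
      iS : T (mem i S)
      jS : T (mem j S)
      ui : T (mem u (σ i))
      vj : T (mem v (σ j))
      ij : T (sC S i j)

  piRel-elim : ∀ S u v → T (piRel S u v) → (u ≡ v) ⊎ Linked S u v
  piRel-elim S u v t with ∨-elim {u ==F v} t
  ... | inj₁ x = inj₁ (==F-≡ x)
  ... | inj₂ y = let (i , y1) = anyF-elim {p = λ i → anyF (λ j → mem i S ∧ mem j S ∧ mem u (σ i) ∧ mem v (σ j) ∧ sC S i j)} y
                     (j , y2) = anyF-elim {p = λ j → mem i S ∧ mem j S ∧ mem u (σ i) ∧ mem v (σ j) ∧ sC S i j} y1
                     a1 = ∧-elimʳ {mem i S} y2
                     a2 = ∧-elimʳ {mem j S} a1
                     a3 = ∧-elimʳ {mem u (σ i)} a2 in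
                 inj₂ (lk i j (∧-elimˡ y2) (∧-elimˡ a1) (∧-elimˡ a2) (∧-elimˡ a3) (∧-elimʳ {mem v (σ j)} a3))

  piRel-linked : ∀ S u v → Linked S u v → T (piRel S u v)
  piRel-linked S u v (lk i j iS jS ui vj ij) = ∨-introʳ {u ==F v}
    (anyF-intro {p = λ i → anyF (λ j → mem i S ∧ mem j S ∧ mem u (σ i) ∧ mem v (σ j) ∧ sC S i j)} i
      (anyF-intro {p = λ j → mem i S ∧ mem j S ∧ mem u (σ i) ∧ mem v (σ j) ∧ sC S i j} j
        (∧-intro iS (∧-intro jS (∧-intro ui (∧-intro vj ij))))))

  piRel-≡ : ∀ S u v → u ≡ v → T (piRel S u v)
  piRel-≡ S u .u refl = ∨-introˡ (==F-refl u)

  piRel-isEquivalence : ∀ S → Equiv (piRel S)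
  piRel-isEquivalence S = record { refl = λ {u} → piRel-≡ S u u refl ; sym = sy ; trans = tr }
    where
    sy : ∀ {u v} → T (piRel S u v) → T (piRel S v u)
    sy {u} {v} t with piRel-elim S u v t
    ... | inj₁ e = piRel-≡ S v u (sym e)
    ... | inj₂ (lk i j iS jS ui vj ij) = piRel-linked S v u (lk j i jS iS vj ui (sameComp-sym S i j ij))
    tr : ∀ {u v w} → T (piRel S u v) → T (piRel S v w) → T (piRel S u w)
    tr {u} {v} {w} t1 t2 with piRel-elim S u v t1 | piRel-elim S v w t2
    ... | inj₁ e | _ = subst (λ z → T (piRel S z w)) (sym e) t2
    ... | inj₂ _ | inj₁ e = subst (λ z → T (piRel S u z)) e t1
    ... | inj₂ (lk i j iS jS ui vj ij) | inj₂ (lk k l kS lS vk wl kl) =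
          piRel-linked S u w (lk i l iS lS ui wl (sameComp-trans S i k l (sameComp-trans S i j k ij (meet⇒sameComp S j k v jS kS vj vk)) kl))

  ⊆insideBlocks : Vec Bool m → Vec Bool (#subsets n) → Set
  ⊆insideBlocks S P = ∀ i → T (mem i S) → T (mem i (insideBlocks P))

  ⊆insideBlocks⇒coarsens : ∀ S P → IsPartition n P → ⊆insideBlocks S P → Coarsens {n} (piRel S) P
  ⊆insideBlocks⇒coarsens S P pp sb u v t with piRel-elim S u v t
  ... | inj₁ refl = let (A , a , ua) = IsPartition.covers pp u in A , a , ua , ua
  ... | inj₂ (lk i j iS jS ui vj ij) =
        let (A , a , f) = insideBlocks-elim P i (sb i iS) in
        A , a , f u ui , reachIn-withinBlock P pp S sb m i j A a f ij v vj

  coarsens⇒⊆insideBlocks : ∀ S P → IsPartition n P → Coarsens {n} (piRel S) P → ⊆insideBlocks S P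
  coarsens⇒⊆insideBlocks S P pp c i iS = insideBlocks-intro P i A0 a0 f
    where
    v0 = proj₁ (simplex-nonempty i)
    v0i = proj₂ (simplex-nonempty i)
    c0 = c v0 v0 (piRel-≡ S v0 v0 refl)
    A0 = proj₁ c0
    a0 = proj₁ (proj₂ c0)
    f : σ i ⊑ A0
    f w wi = let (A , a , v0A , wA) = c v0 w (piRel-linked S v0 w (lk i i iS iS v0i wi (sameComp-refl S i))) in
             subst (λ z → T (mem w z)) (IsPartition.disjoint pp A A0 v0 a a0 v0A (proj₁ (proj₂ (proj₂ c0)))) wA


  coarsePartitions-piRel : ∀ r S → coarsePartitions n r (piRel S) ≡ count (subsetType (#subsets n)) (λ P → isPartitionIntoᵇ {n} r P ∧ subB S (insideBlocks P))
  coarsePartitions-piRel r S = count-cong (subsetType (#subsets n)) (λ P → T⇔T⇒≡ (fw P) (bw P))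
    where
    fw : ∀ P → T (isPartitionIntoᵇ {n} r P ∧ coarsensᵇ {n} (piRel S) P) → T (isPartitionIntoᵇ {n} r P ∧ subB S (insideBlocks P))
    fw P t = let pp = proj₁ (isPartitionIntoᵇ-sound r P (∧-elimˡ t)) in
             ∧-intro (∧-elimˡ t) (subB-intro S (insideBlocks P) (coarsens⇒⊆insideBlocks S P pp (coarsensᵇ-sound (piRel S) P (∧-elimʳ {isPartitionIntoᵇ {n} r P} t))))
    bw : ∀ P → T (isPartitionIntoᵇ {n} r P ∧ subB S (insideBlocks P)) → T (isPartitionIntoᵇ {n} r P ∧ coarsensᵇ {n} (piRel S) P)
    bw P t = let pp = proj₁ (isPartitionIntoᵇ-sound r P (∧-elimˡ t)) in
             ∧-intro (∧-elimˡ t) (coarsensᵇ-complete (piRel S) P (⊆insideBlocks⇒coarsens S P pp (subB-elim S (insideBlocks P) (∧-elimʳ {isPartitionIntoᵇ {n} r P} t))))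

  -- A class of piRel S is counted at its least vertex v. If v ∉ V(S) the class is {v}; otherwise
  -- v is matched with the least simplex of the component through v, and numComponents counts
  -- the components by their least simplex.
  module Classes (S : Vec Bool m) where
    E = piRel S
    eqv = piRel-isEquivalence S
    leastVertexᵇ : Fin n → Bool
    leastVertexᵇ v = not (anyF (λ w → (w <F v) ∧ E w v))
    inVᵇ : Fin n → Bool
    inVᵇ v = mem v (V K s S)
    leastSimplexᵇ : Fin m → Bool
    leastSimplexᵇ i = mem i S ∧ not (anyF (λ j → (j <F i) ∧ mem j S ∧ sC S j i))

    inVᵇ-elim : ∀ v → T (inVᵇ v) → Σ (Fin m) λ k → T (mem k S) × T (mem v (σ k))
    inVᵇ-elim v t = let (k , y) = anyF-elim {p = λ k → mem k S ∧ mem v (σ k)} (subst T (mem-V S v) t) in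
                   k , ∧-elimˡ y , ∧-elimʳ {mem k S} y
    inVᵇ-intro : ∀ v k → T (mem k S) → T (mem v (σ k)) → T (inVᵇ v)
    inVᵇ-intro v k kS vk = subst T (sym (mem-V S v)) (anyF-intro {p = λ k → mem k S ∧ mem v (σ k)} k (∧-intro kS vk))

    leastVertexᵇ-elim : ∀ v → T (leastVertexᵇ v) → ∀ w → T (w <F v) → T (E w v) → ⊥
    leastVertexᵇ-elim v t w lt e = not-elim t (anyF-intro {p = λ w → (w <F v) ∧ E w v} w (∧-intro lt e))

    leastVertex-outsideV : ∀ v → (leastVertexᵇ v ∧ not (inVᵇ v)) ≡ not (inVᵇ v)
    leastVertex-outsideV v = T⇔T⇒≡ (λ t → ∧-elimʳ {leastVertexᵇ v} t) (λ t → ∧-intro (not-intro (λ x → h t x)) t)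
      where
      h : T (not (inVᵇ v)) → T (anyF (λ w → (w <F v) ∧ E w v)) → ⊥
      h nv x with anyF-elim {p = λ w → (w <F v) ∧ E w v} x
      ... | (w , y) with piRel-elim S w v (∧-elimʳ {w <F v} y)
      ... | inj₁ refl = <F-irr w (∧-elimˡ y)
      ... | inj₂ (lk i j iS jS ui vj ij) = not-elim nv (inVᵇ-intro v j jS vj)

    simplexThrough : ∀ v → T (leastVertexᵇ v ∧ inVᵇ v) → Σ (Fin m) λ k → T (mem k S) × T (mem v (σ k))
    simplexThrough v t = inVᵇ-elim v (∧-elimʳ {leastVertexᵇ v} t)
    leastLinkedSimplex : ∀ v t → Σ (Fin m) λ j → T (mem j S ∧ sC S j (proj₁ (simplexThrough v t))) × (∀ k → T (k <F j) → T (mem k S ∧ sC S k (proj₁ (simplexThrough v t))) → ⊥)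
    leastLinkedSimplex v t = let (k , kS , vk) = simplexThrough v t in leastWitness (λ j → mem j S ∧ sC S j k) k (∧-intro kS (sameComp-refl S k))
    leastSimplexOf : ∀ v → T (leastVertexᵇ v ∧ inVᵇ v) → Fin m
    leastSimplexOf v t = proj₁ (leastLinkedSimplex v t)

    leastLinkedVertex : ∀ i → Σ (Fin n) λ w → T (E w (proj₁ (simplex-nonempty i))) × (∀ k → T (k <F w) → T (E k (proj₁ (simplex-nonempty i))) → ⊥)
    leastLinkedVertex i = leastWitness (λ w → E w (proj₁ (simplex-nonempty i))) (proj₁ (simplex-nonempty i)) (IsEquivalence.refl eqv)
    leastVertexOf : ∀ i → T (leastSimplexᵇ i) → Fin n
    leastVertexOf i _ = proj₁ (leastLinkedVertex i)

    Fq : ∀ v t → T (leastSimplexᵇ (leastSimplexOf v t))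
    Fq v t = ∧-intro (∧-elimˡ (proj₁ (proj₂ (leastLinkedSimplex v t)))) (not-intro h)
      where
      k = proj₁ (simplexThrough v t)
      j = leastSimplexOf v t
      jk = ∧-elimʳ {mem j S} (proj₁ (proj₂ (leastLinkedSimplex v t)))
      h : T (anyF (λ j' → (j' <F j) ∧ mem j' S ∧ sC S j' j)) → ⊥
      h x = let (j' , y) = anyF-elim {p = λ j' → (j' <F j) ∧ mem j' S ∧ sC S j' j} x
                y2 = ∧-elimʳ {j' <F j} y in
            proj₂ (proj₂ (leastLinkedSimplex v t)) j' (∧-elimˡ y) (∧-intro (∧-elimˡ y2) (sameComp-trans S j' j k (∧-elimʳ {mem j' S} y2) jk))

    Gp : ∀ i t → T (leastVertexᵇ (leastVertexOf i t) ∧ inVᵇ (leastVertexOf i t))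
    Gp i t = ∧-intro (not-intro h) iv
      where
      w = leastVertexOf i t
      v0 = proj₁ (simplex-nonempty i)
      ew = proj₁ (proj₂ (leastLinkedVertex i))
      h : T (anyF (λ w' → (w' <F w) ∧ E w' w)) → ⊥
      h x = let (w' , y) = anyF-elim {p = λ w' → (w' <F w) ∧ E w' w} x in
            proj₂ (proj₂ (leastLinkedVertex i)) w' (∧-elimˡ y) (IsEquivalence.trans eqv (∧-elimʳ {w' <F w} y) ew)
      iv : T (inVᵇ w)
      iv with piRel-elim S w v0 ew
      ... | inj₁ e = inVᵇ-intro w i (∧-elimˡ t) (subst (λ z → T (mem z (σ i))) (sym e) (proj₂ (simplex-nonempty i)))
      ... | inj₂ (lk a b aS bS wa v0b ab) = inVᵇ-intro w a aS wa

    GF : ∀ v t qy → leastVertexOf (leastSimplexOf v t) qy ≡ v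
    GF v t qy = aux (<F-tri w v)
      where
      k = proj₁ (simplexThrough v t)
      kS = proj₁ (proj₂ (simplexThrough v t))
      vk = proj₂ (proj₂ (simplexThrough v t))
      j = leastSimplexOf v t
      jS = ∧-elimˡ (proj₁ (proj₂ (leastLinkedSimplex v t)))
      jk = ∧-elimʳ {mem j S} (proj₁ (proj₂ (leastLinkedSimplex v t)))
      v0 = proj₁ (simplex-nonempty j)
      w = leastVertexOf j qy
      ew = proj₁ (proj₂ (leastLinkedVertex j))
      evv0 : T (E v v0)
      evv0 = piRel-linked S v v0 (lk k j kS jS vk (proj₂ (simplex-nonempty j)) (sameComp-sym S j k jk))
      aux : T (w <F v) ⊎ (w ≡ v) ⊎ T (v <F w) → w ≡ v
      aux (inj₂ (inj₁ e)) = e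
      aux (inj₁ lt) = ⊥-elim (leastVertexᵇ-elim v (∧-elimˡ t) w lt (IsEquivalence.trans eqv ew (IsEquivalence.sym eqv evv0)))
      aux (inj₂ (inj₂ lt)) = ⊥-elim (proj₂ (proj₂ (leastLinkedVertex j)) v lt evv0)

    FG : ∀ i qy px → leastSimplexOf (leastVertexOf i qy) px ≡ i
    FG i qy px = aux (<F-tri j i)
      where
      iS = ∧-elimˡ qy
      w = leastVertexOf i qy
      v0 = proj₁ (simplex-nonempty i)
      v0i = proj₂ (simplex-nonempty i)
      ew = proj₁ (proj₂ (leastLinkedVertex i))
      k = proj₁ (simplexThrough w px)
      kS = proj₁ (proj₂ (simplexThrough w px))
      wk = proj₂ (proj₂ (simplexThrough w px))
      j = leastSimplexOf w px
      jS = ∧-elimˡ (proj₁ (proj₂ (leastLinkedSimplex w px)))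
      jk = ∧-elimʳ {mem j S} (proj₁ (proj₂ (leastLinkedSimplex w px)))
      ki : T (sC S k i)
      ki with piRel-elim S w v0 ew
      ... | inj₁ e = meet⇒sameComp S k i v0 kS iS (subst (λ z → T (mem z (σ k))) e wk) v0i
      ... | inj₂ (lk a b aS bS wa v0b ab) = sameComp-trans S k a i (meet⇒sameComp S k a w kS aS wk wa) (sameComp-trans S a b i ab (meet⇒sameComp S b i v0 bS iS v0b v0i))
      aux : T (j <F i) ⊎ (j ≡ i) ⊎ T (i <F j) → j ≡ i
      aux (inj₂ (inj₁ e)) = e
      aux (inj₁ lt) = ⊥-elim (not-elim (∧-elimʳ {mem i S} qy)
                      (anyF-intro {p = λ j' → (j' <F i) ∧ mem j' S ∧ sC S j' i} j (∧-intro lt (∧-intro jS (sameComp-trans S j k i jk ki)))))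
      aux (inj₂ (inj₂ lt)) = ⊥-elim (proj₂ (proj₂ (leastLinkedSimplex w px)) i lt (∧-intro iS (sameComp-sym S k i ki)))

    leastVertex-insideV : count (finType n) (λ v → leastVertexᵇ v ∧ inVᵇ v) ≡ count (finType m) leastSimplexᵇ
    leastVertex-insideV = count-bijection (finType n) (finType m) (λ v → leastVertexᵇ v ∧ inVᵇ v) leastSimplexᵇ leastSimplexOf leastVertexOf Fq Gp GF FG

    classCount-piRel : classCount E ≡ piSize K s S
    classCount-piRel =
      trans (countF≡count leastVertexᵇ)
      (trans (count-split (finType n) leastVertexᵇ inVᵇ)
      (trans (cong₂ _+_ leastVertex-insideV (count-cong (finType n) leastVertex-outsideV))
      (sym (cong₂ _+_ (countF≡count leastSimplexᵇ) (countF≡count (λ v → not (inVᵇ v)))))))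

-- The Möbius function of L^s(K)

0ℤ : ℤ
0ℤ = ℤ.+ 0

module Möbius {n : ℕ} (K : SimplicialComplex n) (s : ℕ) where
  m = mFs K s
  μ = μ∅ K s
  iL = inL K s
  ss = strictSubB K s

  ΣZ : (Vec Bool m → ℤ) → ℤ
  ΣZ = ΣSubset ℤ+ m

  sumℤ-Ls : (f : Vec Bool m → ℤ) → sumℤ (map f (Ls K s)) ≡ ΣZ (λ U → if iL U then f U else 0ℤ)
  sumℤ-Ls f = trans (sumℤ-map≡listSum f (Ls K s)) (trans (listSum-filter ℤ+ f iL (subsets m)) (listSum-subsets ℤ+ m _))

  ΣstrictlyBelow : Vec Bool m → (Vec Bool m → ℤ) → ℤ
  ΣstrictlyBelow U f = ΣZ (λ U' → if iL U' then (if ss U' U then f U' else 0ℤ) else 0ℤ)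

  ΣstrictlyBelow-cong : ∀ U {f g : Vec Bool m → ℤ} → (∀ U' → T (ss U' U) → f U' ≡ g U') →
                        ΣstrictlyBelow U f ≡ ΣstrictlyBelow U g
  ΣstrictlyBelow-cong U {f} {g} e = sum-cong (subsetSummation m) ℤ+ pointwise
    where
    pointwise : ∀ U' → (if iL U' then (if ss U' U then f U' else 0ℤ) else 0ℤ)
                     ≡ (if iL U' then (if ss U' U then g U' else 0ℤ) else 0ℤ)
    pointwise U' with iL U' | ss U' U in U'⊂U
    ... | false | _ = refl
    ... | true | false = refl
    ... | true | true = e U' (subst T (sym U'⊂U) tt)

  sum-strictSubB : ∀ k U → sumℤ (map (mobiusAux K s k) (filterᵇ (λ U' → ss U' U) (Ls K s)))
                           ≡ ΣstrictlyBelow U (mobiusAux K s k)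
  sum-strictSubB k U = trans (sumℤ-map≡listSum (mobiusAux K s k) (filterᵇ (λ U' → ss U' U) (Ls K s)))
                     (trans (listSum-filter ℤ+ (mobiusAux K s k) (λ U' → ss U' U) (filterᵇ iL (subsets m)))
                     (trans (listSum-filter ℤ+ _ iL (subsets m)) (listSum-subsets ℤ+ m _)))

  strictSubB⇒∣∣< : ∀ U' U → T (ss U' U) → ∣ U' ∣ < ∣ U ∣
  strictSubB⇒∣∣< U' U t = subst₂ _<_ (sym (∣∣≡countF U')) (sym (∣∣≡countF U))
                     (NP.≤∧≢⇒< (countF-mono {m} U'⊆U) counts-differ)
    where
    U'⊆U : ∀ i → T (mem i U') → T (mem i U)
    U'⊆U = subB-elim U' U (∧-elimˡ t)
    counts-differ : countF (λ i → mem i U') ≡ countF (λ i → mem i U) → ⊥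
    counts-differ e = not-elim (∧-elimʳ {subB U' U} t)
                        (subB-intro U U' (λ i x → subst T (sym (countF-≡⇒≗ {m} U'⊆U e i)) x))

  strictSubB-empty : ∀ U' U → T (isEmptyB U) → T (ss U' U) → ⊥
  strictSubB-empty U' U empty U'⊂U with ∣ U ∣ in ∣U∣≡ | strictSubB⇒∣∣< U' U U'⊂U
  ... | suc k | _ = let (i , i∈U) = countF-pos (λ i → mem i U) (trans (sym (∣∣≡countF U)) ∣U∣≡) in
                    not-elim empty (anyF-intro i i∈U)

  -- Any fuel exceeding |U| gives the same value, since the recursion only visits strict subsets.
  mobiusAux-fuel : ∀ k k' U → ∣ U ∣ < k → ∣ U ∣ < k' → mobiusAux K s k U ≡ mobiusAux K s k' U
  mobiusAux-fuel (suc k) (suc k') U (s≤s lt) (s≤s lt') with isEmptyB U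
  ... | true = refl
  ... | false = cong ℤ.-_ (begin
    sumℤ (map (mobiusAux K s k) (filterᵇ (λ U' → ss U' U) (Ls K s)))   ≡⟨ sum-strictSubB k U ⟩
    ΣstrictlyBelow U (mobiusAux K s k)   ≡⟨ ΣstrictlyBelow-cong U smaller ⟩
    ΣstrictlyBelow U (mobiusAux K s k')  ≡⟨ sym (sum-strictSubB k' U) ⟩
    sumℤ (map (mobiusAux K s k') (filterᵇ (λ U' → ss U' U) (Ls K s)))  ∎)
    where
    open ≡-Reasoning
    smaller : ∀ U' → T (ss U' U) → mobiusAux K s k U' ≡ mobiusAux K s k' U'
    smaller U' U'⊂U = let c = strictSubB⇒∣∣< U' U U'⊂U in
                      mobiusAux-fuel k k' U' (NP.<-≤-trans c lt) (NP.<-≤-trans c lt')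

  μ-recursion : ∀ U → μ U ≡ (if isEmptyB U then ℤ.+ 1 else ℤ.- ΣstrictlyBelow U μ)
  μ-recursion U with isEmptyB U
  ... | true = refl
  ... | false = cong ℤ.-_ (trans (sum-strictSubB ∣ U ∣ U) (ΣstrictlyBelow-cong U towards-μ))
    where
    towards-μ : ∀ U' → T (ss U' U) → mobiusAux K s ∣ U ∣ U' ≡ μ U'
    towards-μ U' U'⊂U = mobiusAux-fuel ∣ U ∣ (suc ∣ U' ∣) U' (strictSubB⇒∣∣< U' U U'⊂U) NP.≤-refl

  split-⊆ : ∀ (a e sb sr : Bool) (x : ℤ) → (T e → T sb × T sr) → (T sb → T sr → T e) →
           (if a ∧ sb then x else 0ℤ) ≡ (if e then (if a then x else 0ℤ) else 0ℤ) ℤ.+ (if a then (if sb ∧ not sr then x else 0ℤ) else 0ℤ)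
  split-⊆ false e sb sr x f g with e
  ... | true = refl
  ... | false = refl
  split-⊆ true true sb sr x f g with f tt
  split-⊆ true true true true x f g | tt , tt = sym (ZP.+-identityʳ x)
  split-⊆ true false false sr x f g = refl
  split-⊆ true false true false x f g = sym (ZP.+-identityˡ x)
  split-⊆ true false true true x f g = ⊥-elim (g tt tt)

  vecEqᵇ⇒subB : ∀ (U U' : Vec Bool m) → T (vecEqᵇ U U') → T (subB U' U) × T (subB U U')
  vecEqᵇ⇒subB U U' t with vecEqᵇ⇒≡ {A = U} {B = U'} t
  ... | refl = subB-intro U U (λ _ x → x) , subB-intro U U (λ _ x → x)

  subB⇒vecEqᵇ : ∀ (U U' : Vec Bool m) → T (subB U' U) → T (subB U U') → T (vecEqᵇ U U')
  subB⇒vecEqᵇ U U' a b = ≡⇒vecEqᵇ {A = U} {B = U'} (vecExt (λ i → T⇔T⇒≡ (subB-elim U U' b i) (subB-elim U' U a i)))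

  Σbelow-split : ∀ U → T (iL U) → ΣZ (λ U' → if iL U' ∧ subB U' U then μ U' else 0ℤ) ≡ μ U ℤ.+ ΣstrictlyBelow U μ
  Σbelow-split U U∈L =
    trans (sum-cong (subsetSummation m) ℤ+ (λ U' → split-⊆ (iL U') (vecEqᵇ U U') (subB U' U) (subB U U') (μ U')
                                                            (vecEqᵇ⇒subB U U') (subB⇒vecEqᵇ U U')))
    (trans (sum-⊕ (subsetSummation m) ℤ+ _ _)
    (cong (ℤ._+ ΣstrictlyBelow U μ) (trans (sum-delta (subsetType m) ℤ+ U (λ U' → if iL U' then μ U' else 0ℤ))
                                          (cong (λ b → if b then μ U else 0ℤ) (T⇒≡true U∈L)))))

  μ∅-sum-below : ∀ U → T (iL U) → ΣZ (λ U' → if iL U' ∧ subB U' U then μ U' else 0ℤ) ≡ (if isEmptyB U then ℤ.+ 1 else 0ℤ)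
  μ∅-sum-below U U∈L = trans (Σbelow-split U U∈L) (by-emptiness (isEmptyB U) refl)
    where
    by-emptiness : ∀ b → isEmptyB U ≡ b → μ U ℤ.+ ΣstrictlyBelow U μ ≡ (if b then ℤ.+ 1 else 0ℤ)
    by-emptiness true e = cong₂ ℤ._+_ (trans (μ-recursion U) (cong (λ b → if b then ℤ.+ 1 else ℤ.- ΣstrictlyBelow U μ) e))
                                      (trans (sum-cong (subsetSummation m) ℤ+ nothing-below) (sum-ε (subsetSummation m) ℤ+))
      where
      nothing-below : ∀ U' → (if iL U' then (if ss U' U then μ U' else 0ℤ) else 0ℤ) ≡ 0ℤ
      nothing-below U' with iL U' | ss U' U in U'⊂U
      ... | false | _ = refl
      ... | true | false = refl
      ... | true | true = ⊥-elim (strictSubB-empty U' U (subst T (sym e) tt) (subst T (sym U'⊂U) tt))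
    by-emptiness false e = trans (cong (ℤ._+ ΣstrictlyBelow U μ) (trans (μ-recursion U) (cong (λ b → if b then ℤ.+ 1 else ℤ.- ΣstrictlyBelow U μ) e)))
                                 (ZP.+-inverseˡ (ΣstrictlyBelow U μ))

ΣSubset-comm : ∀ M m k (f : Vec Bool m → Vec Bool k → Carrier M) →
               ΣSubset M m (λ x → ΣSubset M k (f x)) ≡ ΣSubset M k (λ y → ΣSubset M m (λ x → f x y))
ΣSubset-comm M m k = sum-swap (subsetSummation m) M (ΣSubset M k) (sum-⊕ (subsetSummation k) M)
                              (sum-ε (subsetSummation k) M) (sum-cong (subsetSummation k) M)

ℤ-count : ∀ n (q : Vec Bool n → Bool) → ℤ.+ (count (subsetType n) q) ≡ ΣSubset ℤ+ n (λ x → if q x then ℤ.+ 1 else 0ℤ)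
ℤ-count n q = trans (sym (sum-hom (subsetSummation n) ℕ+ ℤ+ ℤ.+_ (ZP.pos-+ , refl) (λ x → ⟦ q x ⟧)))
                    (sum-cong (subsetSummation n) ℤ+ (λ x → ℤ-⟦⟧ (q x)))
  where
  ℤ-⟦⟧ : ∀ b → ℤ.+ ⟦ b ⟧ ≡ (if b then ℤ.+ 1 else 0ℤ)
  ℤ-⟦⟧ true = refl
  ℤ-⟦⟧ false = refl

*-ℤ-count : ∀ n x (q : Vec Bool n → Bool) → x ℤ.* ℤ.+ (count (subsetType n) q) ≡ ΣSubset ℤ+ n (λ y → if q y then x else 0ℤ)
*-ℤ-count n x q =
  trans (cong (x ℤ.*_) (ℤ-count n q))
  (trans (sym (sum-hom (subsetSummation n) ℤ+ ℤ+ (x ℤ.*_) (ZP.*-distribˡ-+ x , ZP.*-zeroʳ x) _))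
         (sum-cong (subsetSummation n) ℤ+ (λ y → x*-if (q y))))
  where
  x*-if : ∀ b → x ℤ.* (if b then ℤ.+ 1 else 0ℤ) ≡ (if b then x else 0ℤ)
  x*-if true = ZP.*-identityʳ x
  x*-if false = ZP.*-zeroʳ x

module MöbiusInversion {n : ℕ} (K : SimplicialComplex n) (s r : ℕ) where
  open InsideBlocks K s
  open PiPartition K s
  open Möbius K s using (μ∅-sum-below; μ; iL; ΣZ)

  N : ℕ
  N = #subsets n

  partitionᵇ : Vec Bool N → Bool
  partitionᵇ = isPartitionIntoᵇ {n} r

  goodᵇ : Vec Bool N → Bool
  goodᵇ P = partitionᵇ P ∧ noBlockContainsSimplex K s P

  noBlockContainsSimplex≡insideBlocks-empty : ∀ P → noBlockContainsSimplex K s P ≡ isEmptyB (insideBlocks P)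
  noBlockContainsSimplex≡insideBlocks-empty P = T⇔T⇒≡ fw bw
    where
    containsSimplex : Fin N → Bool
    containsSimplex b = anyF (λ i → subB (σ i) (subsetAt {n} b))
    fw : T (noBlockContainsSimplex K s P) → T (isEmptyB (insideBlocks P))
    fw t = not-intro (λ x → let (i , y) = anyF-elim {p = λ i → mem i (insideBlocks P)} x
                                (b , z) = anyF-elim {p = λ b → mem b P ∧ subB (σ i) (subsetAt {n} b)} (subst T (lookup∘tabulate _ i) y)
                                w = allF-elim {p = λ b → not (mem b P) ∨ not (containsSimplex b)} t b in
                            h (∨-elim {not (mem b P)} w) z)
      where
      h : ∀ {b i} → T (not (mem b P)) ⊎ T (not (containsSimplex b)) → T (mem b P ∧ subB (σ i) (subsetAt {n} b)) → ⊥
      h (inj₁ u) z = not-elim u (∧-elimˡ z)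
      h {b} {i} (inj₂ u) z = not-elim u (anyF-intro {p = λ i → subB (σ i) (subsetAt {n} b)} i (∧-elimʳ {mem b P} z))
    bw : T (isEmptyB (insideBlocks P)) → T (noBlockContainsSimplex K s P)
    bw t = allF-intro {p = λ b → not (mem b P) ∨ not (containsSimplex b)} (λ b → h b (T-dec (mem b P)))
      where
      h : ∀ b → T (mem b P) ⊎ T (not (mem b P)) → T (not (mem b P) ∨ not (containsSimplex b))
      h b (inj₂ y) = ∨-introˡ y
      h b (inj₁ x) = ∨-introʳ {not (mem b P)} (not-intro (λ y →
          let (i , z) = anyF-elim {p = λ i → subB (σ i) (subsetAt {n} b)} y in
          not-elim t (anyF-intro {p = λ i → mem i (insideBlocks P)} i (subst T (sym (lookup∘tabulate _ i))
              (anyF-intro {p = λ b → mem b P ∧ subB (σ i) (subsetAt {n} b)} b (∧-intro x z))))))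

  stirling2-piSize : ∀ U → stirling2 (piSize K s U) r ≡ count (subsetType N) (λ P → partitionᵇ P ∧ subB U (insideBlocks P))
  stirling2-piSize U = begin
    stirling2 (piSize K s U) r                ≡⟨ cong (λ c → stirling2 c r) (sym (Classes.classCount-piRel U)) ⟩
    stirling2 (classCount (piRel U)) r        ≡⟨ sym (coarsePartitions≡stirling2 n (piRel U) (piRel-isEquivalence U) r) ⟩
    coarsePartitions n r (piRel U)            ≡⟨ coarsePartitions-piRel r U ⟩
    count (subsetType N) (λ P → partitionᵇ P ∧ subB U (insideBlocks P))  ∎
    where open ≡-Reasoning

  weight : Vec Bool m → Vec Bool N → ℤ
  weight U P = if iL U ∧ (partitionᵇ P ∧ subB U (insideBlocks P)) then μ U else 0ℤ

  Σweight-partitions : ∀ U → ΣSubset ℤ+ N (weight U) ≡ (if iL U then μ U ℤ.* ℤ.+ (stirling2 (piSize K s U) r) else 0ℤ)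
  Σweight-partitions U with iL U
  ... | true = sym (trans (cong (λ c → μ U ℤ.* ℤ.+ c) (stirling2-piSize U)) (*-ℤ-count N (μ U) _))
  ... | false = sum-ε (subsetSummation N) ℤ+

  Σweight-L : ∀ P → ΣZ (λ U → weight U P) ≡ (if goodᵇ P then ℤ.+ 1 else 0ℤ)
  Σweight-L P with T-dec (partitionᵇ P)
  ... | inj₁ P-partition = begin
    ΣZ (λ U → weight U P)
      ≡⟨ sum-cong (subsetSummation m) ℤ+ (λ U → cong (λ b → if iL U ∧ (b ∧ subB U (insideBlocks P)) then μ U else 0ℤ)
                                                     (T⇒≡true P-partition)) ⟩
    ΣZ (λ U → if iL U ∧ subB U (insideBlocks P) then μ U else 0ℤ)
      ≡⟨ μ∅-sum-below (insideBlocks P) (insideBlocks∈L P (proj₁ (isPartitionIntoᵇ-sound r P P-partition))) ⟩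
    (if isEmptyB (insideBlocks P) then ℤ.+ 1 else 0ℤ)
      ≡⟨ cong (λ b → if b then ℤ.+ 1 else 0ℤ) (sym (noBlockContainsSimplex≡insideBlocks-empty P)) ⟩
    (if noBlockContainsSimplex K s P then ℤ.+ 1 else 0ℤ)
      ≡⟨ cong (λ b → if b ∧ noBlockContainsSimplex K s P then ℤ.+ 1 else 0ℤ) (sym (T⇒≡true P-partition)) ⟩
    (if goodᵇ P then ℤ.+ 1 else 0ℤ)  ∎
    where open ≡-Reasoning
  ... | inj₂ P-not-partition = begin
    ΣZ (λ U → weight U P)
      ≡⟨ sum-cong (subsetSummation m) ℤ+ (λ U → cong (λ b → if iL U ∧ (b ∧ subB U (insideBlocks P)) then μ U else 0ℤ)
                                                     (¬T⇒≡false (not-elim P-not-partition))) ⟩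
    ΣZ (λ U → if iL U ∧ false then μ U else 0ℤ)
      ≡⟨ sum-cong (subsetSummation m) ℤ+ (λ U → cong (λ b → if b then μ U else 0ℤ) (∧-zeroʳ (iL U))) ⟩
    ΣZ (λ _ → 0ℤ)
      ≡⟨ sum-ε (subsetSummation m) ℤ+ ⟩
    0ℤ
      ≡⟨ cong (λ b → if b ∧ noBlockContainsSimplex K s P then ℤ.+ 1 else 0ℤ) (sym (¬T⇒≡false (not-elim P-not-partition))) ⟩
    (if goodᵇ P then ℤ.+ 1 else 0ℤ)  ∎
    where open ≡-Reasoning

  S≡Σgood : ℤ.+ (S K s r) ≡ ΣSubset ℤ+ N (λ P → if goodᵇ P then ℤ.+ 1 else 0ℤ)
  S≡Σgood = trans (cong ℤ.+_ (length-filter-subsets N goodᵇ)) (ℤ-count N goodᵇ)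

theorem2p30 : (n : ℕ) (K : SimplicialComplex n) → 1 ≤ n →
    (s r : ℕ) → 1 ≤ s → 1 ≤ r →
    ℤ.+ (S K s r)
    ≡ sumℤ (map (λ T → μ∅ K s T ℤ.* ℤ.+ (stirling2 (piSize K s T) r)) (Ls K s))
theorem2p30 n K _ s r _ _ = begin
  ℤ.+ (S K s r)                                          ≡⟨ S≡Σgood ⟩
  ΣSubset ℤ+ N (λ P → if goodᵇ P then ℤ.+ 1 else 0ℤ)      ≡⟨ sum-cong (subsetSummation N) ℤ+ (λ P → sym (Σweight-L P)) ⟩
  ΣSubset ℤ+ N (λ P → ΣZ (λ U → weight U P))             ≡⟨ sym (ΣSubset-comm ℤ+ m N weight) ⟩
  ΣZ (λ U → ΣSubset ℤ+ N (weight U))                     ≡⟨ sum-cong (subsetSummation m) ℤ+ Σweight-partitions ⟩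
  ΣZ (λ U → if iL U then μ U ℤ.* ℤ.+ (stirling2 (piSize K s U) r) else 0ℤ)
                                                         ≡⟨ sym (sumℤ-Ls _) ⟩
  sumℤ (map (λ T → μ∅ K s T ℤ.* ℤ.+ (stirling2 (piSize K s T) r)) (Ls K s))  ∎
  where
  open MöbiusInversion K s r
  open Möbius K s using (m; ΣZ; iL; μ; sumℤ-Ls)
  open ≡-Reasoning
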